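{- Let $\mathcal C(\Lambda_1)=\{c_M=(\mathrm{Tr}(X_1M),\dots,\mathrm{Tr}(X_NM)):M\in M_{n+1}(q)\}$ be the code associated to the projective system $\Lambda_1=\{[X_1],\dots,[X_N]\}$ of all points $[x\xi]\in\mathrm{PG}(M_{n+1}(q))$ with $x$ a nonzero column vector, $\xi$ a nonzero row vector, $\xi x=0$. Then every minimum weight codeword of $\mathcal C(\Lambda_1)$ corresponds to a hyperplane of the form $[N^{\perp_f}]$, i.e. has the set of zero coordinates $\Lambda_1\cap[N^{\perp_f}]$ (equivalently is of the form $c_N$), where $N$ is a matrix of rank $1$ with $\mathrm{Tr}(N)\neq0$.
   Context: $N^{\perp_f}=\{X\in M_{n+1}(q):\mathrm{Tr}(XN)=0\}$, and $[N^{\perp_f}]$ is the corresponding projective hyperplane of $\mathrm{PG}(M_{n+1}(q))$. -}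

module Defs where

open import Data.Nat using (ℕ; suc)
open import Data.Fin using (Fin)
open import Data.List using (List; length; filter; allFin; foldr)
open import Data.List.Membership.Propositional using (_∈_)
open import Data.List.Relation.Unary.Unique.Propositional using (Unique)
open import Data.Product using (Σ; ∃; _×_)
open import Relation.Binary.PropositionalEquality using (_≡_; _≢_)
open import Relation.Binary.Definitions using (DecidableEquality)
open import Relation.Nullary.Decidable using (¬?)
open import Algebra.Structures using (IsCommutativeRing)

-- A finite field GF(q): a commutative ring (with propositional equality)
-- in which every nonzero element is invertible, 0 ≠ 1, with decidable
-- equality and a duplicate-free complete enumeration of its elements
-- (so q = length elements).
record FiniteField : Set₁ where
  infixl 6 _+_
  infixl 7 _*_
  field
    Carrier  : Set
    _+_ _*_  : Carrier → Carrier → Carrier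
    -_       : Carrier → Carrier
    0# 1#    : Carrier
    isCommutativeRing : IsCommutativeRing _≡_ _+_ _*_ -_ 0# 1#
    0≢1      : 0# ≢ 1#
    inverse  : ∀ x → x ≢ 0# → Σ Carrier (λ y → x * y ≡ 1#)
    _≟_      : DecidableEquality Carrier
    elements : List Carrier
    complete : ∀ x → x ∈ elements
    unique   : Unique elements

module MatrixDefs (F : FiniteField) (n : ℕ) where
  open FiniteField F

  -- indices 0..n, i.e. (n+1) x (n+1) matrices M_{n+1}(q)
  Idx : Set
  Idx = Fin (suc n)

  Mat : Set
  Mat = Idx → Idx → Carrier

  Col : Set
  Col = Idx → Carrier

  Row : Set
  Row = Idx → Carrier

  sumIdx : (Idx → Carrier) → Carrier
  sumIdx f = foldr (λ i acc → f i + acc) 0# (allFin (suc n))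

  _·_ : Mat → Mat → Mat
  (A · B) i j = sumIdx (λ k → A i k * B k j)

  Tr : Mat → Carrier
  Tr A = sumIdx (λ i → A i i)

  outer : Col → Row → Mat
  outer x ξ i j = x i * ξ j

  rowCol : Row → Col → Carrier
  rowCol ξ x = sumIdx (λ i → ξ i * x i)

  NonzeroVec : (Idx → Carrier) → Set
  NonzeroVec v = ∃ λ i → v i ≢ 0#

  _≐_ : Mat → Mat → Set
  A ≐ B = ∀ i j → A i j ≡ B i j

  -- B is a nonzero scalar multiple of A, i.e. [A] = [B] in PG(M_{n+1}(q))
  SamePoint : Mat → Mat → Set
  SamePoint A B = Σ Carrier λ c → c ≢ 0# × (B ≐ (λ i j → c * A i j))

  InΛ₁ : Mat → Set
  InΛ₁ X = Σ Col λ x → Σ Row λ ξ →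
             NonzeroVec x × NonzeroVec ξ × rowCol ξ x ≡ 0# × (X ≐ outer x ξ)

  Rank1 : Mat → Set
  Rank1 N = Σ Col λ y → Σ Row λ η → NonzeroVec y × NonzeroVec η × (N ≐ outer y η)

  -- Xs : Fin Npts → Mat lists one representative for each point of Λ₁
  IsProjSystemΛ₁ : (Npts : ℕ) → (Fin Npts → Mat) → Set
  IsProjSystemΛ₁ Npts Xs =
      (∀ k → InΛ₁ (Xs k))
    × (∀ Y → InΛ₁ Y → ∃ λ k → SamePoint (Xs k) Y)
    × (∀ k l → SamePoint (Xs k) (Xs l) → k ≡ l)

  codeword : {Npts : ℕ} → (Fin Npts → Mat) → Mat → Fin Npts → Carrier
  codeword Xs M k = Tr (Xs k · M)

  weight : {Npts : ℕ} → (Fin Npts → Carrier) → ℕ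
  weight {Npts} c = length (filter (λ k → ¬? (c k ≟ 0#)) (allFin Npts))

{-# OPTIONS --safe #-}
module Submission where

open import Defs
open import Data.Nat using (ℕ; zero; suc)
open import Data.Fin using (Fin; zero; suc)
open import Algebra.Bundles using (CommutativeRing)

module Counting where

  open import Data.Nat using (ℕ; zero; suc; _+_; _*_; _≤_; _<_; z≤n; s≤s)
  open import Data.Nat.Properties
  open import Data.Nat.ListAction using (sum)
  open import Data.List using (List; []; _∷_; length; filter; map; _++_; cartesianProductWith; cartesianProduct)
  open import Data.List.Properties using (length-++; length-map)
  open import Data.List.Membership.Propositional using (_∈_)
  open import Data.List.Membership.Propositional.Properties using (∈-filter⁺; ∈-filter⁻; ∈-cartesianProduct⁺)
  open import Data.List.Relation.Unary.Any using (Any; here; there; any?)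
  open import Data.List.Relation.Unary.All using (All; _∷_)
  open import Data.List.Relation.Unary.AllPairs using (_∷_)
  open import Data.List.Relation.Unary.Unique.Propositional using (Unique)
  import Data.List.Relation.Unary.Unique.Propositional.Properties as Unique
  open import Data.Product using (Σ; _×_; _,_; proj₁; proj₂)
  open import Data.Sum using (_⊎_; inj₁; inj₂)
  open import Data.Unit using (⊤; tt)
  open import Data.Empty using (⊥-elim)
  open import Relation.Nullary using (¬_; yes; no)
  open import Relation.Nullary.Decidable using (_×-dec_; _⊎-dec_; ¬?)
  open import Relation.Unary using (Decidable)
  open import Relation.Binary.PropositionalEquality using (_≡_; _≢_; refl; sym; trans; cong; cong₂; subst; subst₂; module ≡-Reasoning)

  private variable
    A B C : Set

  count : {P : A → Set} → Decidable P → List A → ℕ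
  count P? xs = length (filter P? xs)

  count-mono : {P Q : A → Set} (P? : Decidable P) (Q? : Decidable Q) (xs : List A) →
               (∀ x → x ∈ xs → P x → Q x) → count P? xs ≤ count Q? xs
  count-mono P? Q? [] P⇒Q = z≤n
  count-mono P? Q? (x ∷ xs) P⇒Q with P? x | Q? x | count-mono P? Q? xs (λ y y∈ → P⇒Q y (there y∈))
  ... | yes _  | yes _  | ih = s≤s ih
  ... | yes px | no ¬qx | _  = ⊥-elim (¬qx (P⇒Q x (here refl) px))
  ... | no _   | yes _  | ih = m≤n⇒m≤1+n ih
  ... | no _   | no _   | ih = ih

  count-cong : {P Q : A → Set} (P? : Decidable P) (Q? : Decidable Q) (xs : List A) →
               (∀ x → x ∈ xs → P x → Q x) → (∀ x → x ∈ xs → Q x → P x) →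
               count P? xs ≡ count Q? xs
  count-cong P? Q? xs P⇒Q Q⇒P = ≤-antisym (count-mono P? Q? xs P⇒Q) (count-mono Q? P? xs Q⇒P)

  count-none : {P : A → Set} (P? : Decidable P) (xs : List A) →
               (∀ x → x ∈ xs → ¬ P x) → count P? xs ≡ 0
  count-none P? [] none = refl
  count-none P? (x ∷ xs) none with P? x
  ... | yes px = ⊥-elim (none x (here refl) px)
  ... | no _   = count-none P? xs (λ y y∈ → none y (there y∈))

  count-all : {P : A → Set} (P? : Decidable P) (xs : List A) →
              (∀ x → x ∈ xs → P x) → count P? xs ≡ length xs
  count-all P? [] all = refl
  count-all P? (x ∷ xs) all with P? x
  ... | yes _  = cong suc (count-all P? xs (λ y y∈ → all y (there y∈)))
  ... | no ¬px = ⊥-elim (¬px (all x (here refl)))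

  count-some : {P : A → Set} (P? : Decidable P) {xs : List A} (x : A) →
               x ∈ xs → P x → 0 < count P? xs
  count-some P? {y ∷ ys} x x∈ px with P? y
  ... | yes _ = s≤s z≤n
  count-some P? {y ∷ ys} x (here refl) px | no ¬py = ⊥-elim (¬py px)
  count-some P? {y ∷ ys} x (there x∈) px  | no _   = count-some P? x x∈ px

  count-split : {P Q : A → Set} (P? : Decidable P) (Q? : Decidable Q) (xs : List A) →
                count P? xs ≡ count (λ x → P? x ×-dec Q? x) xs + count (λ x → P? x ×-dec ¬? (Q? x)) xs
  count-split P? Q? [] = refl
  count-split P? Q? (x ∷ xs) with P? x | Q? x | count-split P? Q? xs
  ... | yes _ | yes _ | ih = cong suc ih
  ... | yes _ | no _  | ih = trans (cong suc ih) (sym (+-suc _ _))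
  ... | no _  | yes _ | ih = ih
  ... | no _  | no _  | ih = ih

  count-complement : {P : A → Set} (P? : Decidable P) (xs : List A) →
                     count P? xs + count (λ x → ¬? (P? x)) xs ≡ length xs
  count-complement P? [] = refl
  count-complement P? (x ∷ xs) with P? x | count-complement P? xs
  ... | yes _ | ih = cong suc ih
  ... | no _  | ih = trans (+-suc _ _) (cong suc ih)

  count-∪ : {P Q : A → Set} (P? : Decidable P) (Q? : Decidable Q) (xs : List A) →
            count (λ x → P? x ⊎-dec Q? x) xs ≤ count P? xs + count Q? xs
  count-∪ P? Q? [] = z≤n
  count-∪ P? Q? (x ∷ xs) with P? x | Q? x | count-∪ P? Q? xs
  ... | yes _ | yes _ | ih = s≤s (≤-trans ih (+-monoʳ-≤ _ (n≤1+n _)))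
  ... | yes _ | no _  | ih = s≤s ih
  ... | no _  | yes _ | ih = ≤-trans (s≤s ih) (≤-reflexive (sym (+-suc _ _)))
  ... | no _  | no _  | ih = ih

  count-≤-length : {P : A → Set} (P? : Decidable P) (xs : List A) → count P? xs ≤ length xs
  count-≤-length P? [] = z≤n
  count-≤-length P? (x ∷ xs) with P? x
  ... | yes _ = s≤s (count-≤-length P? xs)
  ... | no _  = m≤n⇒m≤1+n (count-≤-length P? xs)

  module _ {P : A → Set} (P? : Decidable P) where

    count-++ : (xs ys : List A) → count P? (xs ++ ys) ≡ count P? xs + count P? ys
    count-++ [] ys = refl
    count-++ (x ∷ xs) ys with P? x
    ... | yes _ = cong suc (count-++ xs ys)
    ... | no _  = count-++ xs ys

    count-map : (f : B → A) (ys : List B) → count P? (map f ys) ≡ count (λ y → P? (f y)) ys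
    count-map f [] = refl
    count-map f (y ∷ ys) with P? (f y)
    ... | yes _ = cong suc (count-map f ys)
    ... | no _  = count-map f ys

    count-cartesianProductWith : (f : B → C → A) (ys : List B) (zs : List C) →
      count P? (cartesianProductWith f ys zs) ≡ sum (map (λ y → count (λ z → P? (f y z)) zs) ys)
    count-cartesianProductWith f [] zs = refl
    count-cartesianProductWith f (y ∷ ys) zs =
      trans (count-++ (map (f y) zs) _)
            (cong₂ _+_ (count-map (f y) zs) (count-cartesianProductWith f ys zs))

  sum-mono : (f g : A → ℕ) (xs : List A) → (∀ x → x ∈ xs → f x ≤ g x) →
             sum (map f xs) ≤ sum (map g xs)
  sum-mono f g [] f≤g = z≤n
  sum-mono f g (x ∷ xs) f≤g = +-mono-≤ (f≤g x (here refl)) (sum-mono f g xs (λ y y∈ → f≤g y (there y∈)))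

  sum-cong : (f g : A → ℕ) (xs : List A) → (∀ x → x ∈ xs → f x ≡ g x) →
             sum (map f xs) ≡ sum (map g xs)
  sum-cong f g xs f≡g = ≤-antisym (sum-mono f g xs (λ x x∈ → ≤-reflexive (f≡g x x∈)))
                                  (sum-mono g f xs (λ x x∈ → ≤-reflexive (sym (f≡g x x∈))))

  sum-+ : (f g : A → ℕ) (xs : List A) → sum (map (λ x → f x + g x) xs) ≡ sum (map f xs) + sum (map g xs)
  sum-+ f g [] = refl
  sum-+ f g (x ∷ xs) = trans (cong (f x + g x +_) (sum-+ f g xs)) (+-+-comm (f x) (g x) _ _)
    where
    +-+-comm : ∀ a b c d → (a + b) + (c + d) ≡ (a + c) + (b + d)
    +-+-comm a b c d = solve 4 (λ a b c d → (a :+ b) :+ (c :+ d) := (a :+ c) :+ (b :+ d)) refl a b c d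
      where open import Data.Nat.Solver using (module +-*-Solver)
            open +-*-Solver

  sum-const : (c : ℕ) (xs : List A) → sum (map (λ _ → c) xs) ≡ length xs * c
  sum-const c [] = refl
  sum-const c (x ∷ xs) = cong (c +_) (sum-const c xs)

  sum-indicator : {P : A → Set} (P? : Decidable P) (c : ℕ) (f : A → ℕ) (xs : List A) →
                  (∀ x → x ∈ xs → P x → f x ≡ c) → (∀ x → x ∈ xs → ¬ P x → f x ≡ 0) →
                  sum (map f xs) ≡ count P? xs * c
  sum-indicator P? c f [] on off = refl
  sum-indicator P? c f (x ∷ xs) on off with P? x | sum-indicator P? c f xs (λ y y∈ → on y (there y∈)) (λ y y∈ → off y (there y∈))
  ... | yes px  | ih = cong₂ _+_ (on x (here refl) px) ih
  ... | no ¬px  | ih = cong₂ _+_ (off x (here refl) ¬px) ih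

  private
    remove : {x : A} (ys : List A) → x ∈ ys → List A
    remove (y ∷ ys) (here _)   = ys
    remove (y ∷ ys) (there x∈) = y ∷ remove ys x∈

    length-remove : {x : A} (ys : List A) (x∈ : x ∈ ys) → length ys ≡ suc (length (remove ys x∈))
    length-remove (y ∷ ys) (here _)   = refl
    length-remove (y ∷ ys) (there x∈) = cong suc (length-remove ys x∈)

    ∈-remove : {x z : A} (ys : List A) (x∈ : x ∈ ys) → z ∈ ys → z ≢ x → z ∈ remove ys x∈
    ∈-remove (y ∷ ys) (here refl) (here refl) z≢x = ⊥-elim (z≢x refl)
    ∈-remove (y ∷ ys) (here refl) (there z∈)  z≢x = z∈
    ∈-remove (y ∷ ys) (there x∈)  (here refl) z≢x = here refl
    ∈-remove (y ∷ ys) (there x∈)  (there z∈)  z≢x = there (∈-remove ys x∈ z∈ z≢x)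

    ∉-unique-tail : {x y : A} {xs : List A} → All (x ≢_) xs → y ∈ xs → x ≢ y
    ∉-unique-tail (x≢ ∷ _)  (here refl) = x≢
    ∉-unique-tail (_ ∷ x≢s) (there y∈)  = ∉-unique-tail x≢s y∈

  length-≤-injection : (xs : List A) → Unique xs → (ys : List B) (f : A → B) →
    (∀ x → x ∈ xs → f x ∈ ys) → (∀ x x′ → x ∈ xs → x′ ∈ xs → f x ≡ f x′ → x ≡ x′) →
    length xs ≤ length ys
  length-≤-injection [] _ ys f into inj = z≤n
  length-≤-injection (x ∷ xs) (x∉ ∷ unique) ys f into inj =
    subst (suc (length xs) ≤_) (sym (length-remove ys fx∈))
      (s≤s (length-≤-injection xs unique (remove ys fx∈) f
        (λ y y∈ → ∈-remove ys fx∈ (into y (there y∈))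
                    (λ fy≡fx → ∉-unique-tail x∉ y∈ (sym (inj y x (there y∈) (here refl) fy≡fx))))
        (λ y y′ y∈ y′∈ → inj y y′ (there y∈) (there y′∈))))
    where fx∈ = into x (here refl)

  count-≤-injection : {P : A → Set} {Q : B → Set} (P? : Decidable P) (Q? : Decidable Q)
    (xs : List A) → Unique xs → (ys : List B) → (∀ y → y ∈ ys) →
    (f : A → B) → (∀ x → P x → Q (f x)) → (∀ x x′ → P x → P x′ → f x ≡ f x′ → x ≡ x′) →
    count P? xs ≤ count Q? ys
  count-≤-injection P? Q? xs unique ys complete f P⇒Q inj =
    length-≤-injection (filter P? xs) (Unique.filter⁺ P? unique) (filter Q? ys) f
      (λ x x∈ → ∈-filter⁺ Q? (complete (f x)) (P⇒Q x (proj₂ (∈-filter⁻ P? {xs = xs} x∈))))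
      (λ x x′ x∈ x′∈ → inj x x′ (proj₂ (∈-filter⁻ P? {xs = xs} x∈)) (proj₂ (∈-filter⁻ P? {xs = xs} x′∈)))

  count-≡-bijection : {P : A → Set} {Q : B → Set} (P? : Decidable P) (Q? : Decidable Q)
    (xs : List A) → Unique xs → (∀ x → x ∈ xs) → (ys : List B) → Unique ys → (∀ y → y ∈ ys) →
    (f : A → B) (g : B → A) → (∀ x → g (f x) ≡ x) → (∀ y → f (g y) ≡ y) →
    (∀ x → P x → Q (f x)) → (∀ y → Q y → P (g y)) →
    count P? xs ≡ count Q? ys
  count-≡-bijection P? Q? xs uxs cxs ys uys cys f g gf fg P⇒Q Q⇒P = ≤-antisym
    (count-≤-injection P? Q? xs uxs ys cys f P⇒Q (λ x x′ _ _ e → trans (sym (gf x)) (trans (cong g e) (gf x′))))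
    (count-≤-injection Q? P? ys uys xs cxs g Q⇒P (λ y y′ _ _ e → trans (sym (fg y)) (trans (cong f e) (fg y′))))

  count-≤-1 : {P : A → Set} (P? : Decidable P) (xs : List A) → Unique xs →
              (∀ x x′ → P x → P x′ → x ≡ x′) → count P? xs ≤ 1
  count-≤-1 P? xs unique P-unique =
    count-≤-injection P? (λ (_ : ⊤) → yes tt) xs unique (tt ∷ []) (λ { tt → here refl })
      (λ _ → tt) (λ _ _ → tt) (λ x x′ px px′ _ → P-unique x x′ px px′)

  count-≡-1 : {P : A → Set} (P? : Decidable P) (xs : List A) → Unique xs →
              (x : A) → x ∈ xs → P x → (∀ x′ → P x′ → x′ ≡ x) → count P? xs ≡ 1
  count-≡-1 P? xs unique x x∈ px only-x =
    ≤-antisym (count-≤-1 P? xs unique (λ y y′ py py′ → trans (only-x y py) (sym (only-x y′ py′))))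
              (count-some P? x x∈ px)

  module _ {K : Set} {Q : K → A → Set} (Q? : ∀ k → Decidable (Q k)) where

    private
      sum-count-singleton : (x : A) (ks : List K) →
        sum (map (λ k → count (Q? k) (x ∷ [])) ks) ≡ count (λ k → Q? k x) ks
      sum-count-singleton x [] = refl
      sum-count-singleton x (k ∷ ks) with Q? k x
      ... | yes _ = cong suc (sum-count-singleton x ks)
      ... | no _  = sum-count-singleton x ks

    count-sum-comm : (ks : List K) (xs : List A) →
      sum (map (λ k → count (Q? k) xs) ks) ≡ sum (map (λ x → count (λ k → Q? k x) ks) xs)
    count-sum-comm ks [] = trans (sum-const 0 ks) (*-zeroʳ (length ks))
    count-sum-comm ks (x ∷ xs) = begin
      sum (map (λ k → count (Q? k) (x ∷ xs)) ks)
        ≡⟨ sum-cong _ _ ks (λ k _ → count-++ (Q? k) (x ∷ []) xs) ⟩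
      sum (map (λ k → count (Q? k) (x ∷ []) + count (Q? k) xs) ks)
        ≡⟨ sum-+ _ _ ks ⟩
      sum (map (λ k → count (Q? k) (x ∷ [])) ks) + sum (map (λ k → count (Q? k) xs) ks)
        ≡⟨ cong₂ _+_ (sum-count-singleton x ks) (count-sum-comm ks xs) ⟩
      count (λ k → Q? k x) ks + sum (map (λ y → count (λ k → Q? k y) ks) xs) ∎
      where open ≡-Reasoning

  count-partition : {K : Set} {P : A → Set} {R : K → A → Set} (P? : Decidable P) (R? : ∀ k → Decidable (R k))
    (xs : List A) (ks : List K) → Unique ks →
    (∀ x → P x → Σ K λ k → k ∈ ks × R k x) → (∀ x → P x → ∀ k k′ → R k x → R k′ x → k ≡ k′) →
    count P? xs ≡ sum (map (λ k → count (λ x → P? x ×-dec R? k x) xs) ks)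
  count-partition P? R? xs ks unique class class-unique = sym (begin
    sum (map (λ k → count (λ x → P? x ×-dec R? k x) xs) ks)
      ≡⟨ count-sum-comm (λ k x → P? x ×-dec R? k x) ks xs ⟩
    sum (map (λ x → count (λ k → P? x ×-dec R? k x) ks) xs)
      ≡⟨ sum-indicator P? 1 _ xs (λ x _ px → exactly-one x px) (λ x _ ¬px → count-none _ ks (λ _ _ → ¬px ∘ proj₁)) ⟩
    count P? xs * 1
      ≡⟨ *-identityʳ _ ⟩
    count P? xs ∎)
    where
    open ≡-Reasoning
    open import Function using (_∘_)
    exactly-one : ∀ x → _ → count (λ k → P? x ×-dec R? k x) ks ≡ 1
    exactly-one x px = let (k , k∈ , rkx) = class x px in
      count-≡-1 _ ks unique k k∈ (px , rkx) (λ k′ (_ , rk′x) → class-unique x px k′ k rk′x rkx)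

  count-⋃ : {K : Set} {P : A → Set} {R : K → A → Set} (P? : Decidable P) (R? : ∀ k → Decidable (R k))
    (ks : List K) (xs : List A) → (∀ x → P x → Any (λ k → R k x) ks) →
    count P? xs ≤ sum (map (λ k → count (R? k) xs) ks)
  count-⋃ P? R? [] xs cover = ≤-reflexive (count-none P? xs (λ x _ px → case cover x px of λ ()))
    where open import Function using (case_of_)
  count-⋃ {R = R} P? R? (k ∷ ks) xs cover = begin
    count P? xs
      ≤⟨ count-mono P? (λ x → R? k x ⊎-dec any? (λ k′ → R? k′ x) ks) xs (λ x _ px → split (cover x px)) ⟩
    count (λ x → R? k x ⊎-dec any? (λ k′ → R? k′ x) ks) xs
      ≤⟨ count-∪ (R? k) (λ x → any? (λ k′ → R? k′ x) ks) xs ⟩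
    count (R? k) xs + count (λ x → any? (λ k′ → R? k′ x) ks) xs
      ≤⟨ +-monoʳ-≤ (count (R? k) xs) (count-⋃ (λ x → any? (λ k′ → R? k′ x) ks) R? ks xs (λ _ p → p)) ⟩
    count (R? k) xs + sum (map (λ k′ → count (R? k′) xs) ks) ∎
    where
    open ≤-Reasoning
    split : ∀ {x} → Any (λ k′ → R k′ x) (k ∷ ks) → R k x ⊎ Any (λ k′ → R k′ x) ks
    split (here r)  = inj₁ r
    split (there a) = inj₂ a

  count-cartesianProduct : {P : A → Set} {Q : B → Set} (P? : Decidable P) (Q? : Decidable Q)
    (xs : List A) (ys : List B) →
    count (λ (p : A × B) → P? (proj₁ p) ×-dec Q? (proj₂ p)) (cartesianProduct xs ys) ≡ count P? xs * count Q? ys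
  count-cartesianProduct P? Q? xs ys = trans (count-cartesianProductWith _ _,_ xs ys)
    (sum-indicator P? (count Q? ys) _ xs
      (λ x _ px → count-cong _ Q? ys (λ _ _ → proj₂) (λ _ _ qy → px , qy))
      (λ x _ ¬px → count-none _ ys (λ _ _ → ¬px ∘ proj₁)))
    where open import Function using (_∘_)

  length-cartesianProductWith : (f : A → B → C) (xs : List A) (ys : List B) →
    length (cartesianProductWith f xs ys) ≡ length xs * length ys
  length-cartesianProductWith f [] ys = refl
  length-cartesianProductWith f (x ∷ xs) ys =
    trans (length-++ (map (f x) ys)) (cong₂ _+_ (length-map (f x) ys) (length-cartesianProductWith f xs ys))

module IntegerRingSolver {c ℓ} (R : CommutativeRing c ℓ) where

  open import Data.Nat as ℕ using (ℕ; zero; suc)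
  import Data.Nat.Properties as ℕ
  open import Data.Integer as ℤ using (ℤ; +_; -[1+_]; _⊖_; _◃_; sign; ∣_∣)
  import Data.Integer.Properties as ℤ
  open import Data.Sign as Sign using (Sign)
  open import Data.Maybe using (Maybe; just; nothing)
  open import Relation.Nullary using (yes; no)
  import Relation.Binary.PropositionalEquality as ≡
  import Algebra.Solver.Ring.AlmostCommutativeRing as ACR
  import Algebra.Solver.Ring

  open CommutativeRing R
  open import Algebra.Properties.Ring ring using (-0#≈0#; -‿involutive; -‿distribˡ-*; -‿anti-homo-+; -‿+-comm)
  open import Algebra.Properties.Semiring.Mult semiring using (×-homo-+; ×1-homo-*) renaming (_×_ to _×ₙ_)
  open import Relation.Binary.Reasoning.Setoid setoid

  private
    ⟦_⟧ : ℤ → Carrier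
    ⟦ + n ⟧    = n ×ₙ 1#
    ⟦ -[1+ n ] ⟧ = - (suc n ×ₙ 1#)

    ⟦_⟧ₛ : Sign → Carrier
    ⟦ Sign.+ ⟧ₛ = 1#
    ⟦ Sign.- ⟧ₛ = - 1#

    -‿homo : ∀ i → ⟦ ℤ.- i ⟧ ≈ - ⟦ i ⟧
    -‿homo (+ zero)  = sym -0#≈0#
    -‿homo (+ suc n) = refl
    -‿homo -[1+ n ]  = sym (-‿involutive _)

    ⊖-homo : ∀ m n → ⟦ m ⊖ n ⟧ ≈ m ×ₙ 1# - n ×ₙ 1#
    ⊖-homo m       zero    = sym (trans (+-congˡ -0#≈0#) (+-identityʳ _))
    ⊖-homo zero    (suc n) = sym (+-identityˡ _)
    ⊖-homo (suc m) (suc n) = begin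
      ⟦ suc m ⊖ suc n ⟧                  ≡⟨ ≡.cong ⟦_⟧ (ℤ.[1+m]⊖[1+n]≡m⊖n m n) ⟩
      ⟦ m ⊖ n ⟧                          ≈⟨ ⊖-homo m n ⟩
      m ×ₙ 1# - n ×ₙ 1#                    ≈⟨ sym (+-identityˡ _) ⟩
      0# + (m ×ₙ 1# - n ×ₙ 1#)             ≈⟨ +-congʳ (sym (-‿inverseʳ 1#)) ⟩
      (1# - 1#) + (m ×ₙ 1# - n ×ₙ 1#)      ≈⟨ +-assoc 1# (- 1#) _ ⟩
      1# + (- 1# + (m ×ₙ 1# - n ×ₙ 1#))    ≈⟨ +-congˡ (sym (+-assoc _ _ _)) ⟩
      1# + ((- 1# + m ×ₙ 1#) - n ×ₙ 1#)    ≈⟨ +-congˡ (+-congʳ (+-comm _ _)) ⟩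
      1# + ((m ×ₙ 1# - 1#) - n ×ₙ 1#)      ≈⟨ +-congˡ (+-assoc _ _ _) ⟩
      1# + (m ×ₙ 1# + (- 1# - n ×ₙ 1#))    ≈⟨ sym (+-assoc _ _ _) ⟩
      suc m ×ₙ 1# + (- 1# - n ×ₙ 1#)       ≈⟨ +-congˡ (-‿+-comm 1# (n ×ₙ 1#)) ⟩
      suc m ×ₙ 1# - suc n ×ₙ 1#            ∎

    +-homo : ∀ i j → ⟦ i ℤ.+ j ⟧ ≈ ⟦ i ⟧ + ⟦ j ⟧
    +-homo (+ m)    (+ n)    = ×-homo-+ 1# m n
    +-homo (+ m)    -[1+ n ] = ⊖-homo m (suc n)
    +-homo -[1+ m ] (+ n)    = trans (⊖-homo n (suc m)) (+-comm _ _)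
    +-homo -[1+ m ] -[1+ n ] = begin
      - (suc (suc (m ℕ.+ n)) ×ₙ 1#)         ≡⟨ ≡.cong (λ k → - (suc k ×ₙ 1#)) (≡.sym (ℕ.+-suc m n)) ⟩
      - ((suc m ℕ.+ suc n) ×ₙ 1#)           ≈⟨ -‿cong (×-homo-+ 1# (suc m) (suc n)) ⟩
      - (suc m ×ₙ 1# + suc n ×ₙ 1#)          ≈⟨ sym (-‿+-comm _ _) ⟩
      - (suc m ×ₙ 1#) + - (suc n ×ₙ 1#)      ∎

    ◃-homo : ∀ s n → ⟦ s ◃ n ⟧ ≈ ⟦ s ⟧ₛ * (n ×ₙ 1#)
    ◃-homo s        zero    = sym (zeroʳ _)
    ◃-homo Sign.+ (suc n)   = sym (*-identityˡ _)
    ◃-homo Sign.- (suc n)   = trans (-‿cong (sym (*-identityˡ _))) (-‿distribˡ-* _ _)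

    sign-abs-homo : ∀ i → ⟦ i ⟧ ≈ ⟦ sign i ⟧ₛ * (∣ i ∣ ×ₙ 1#)
    sign-abs-homo i = trans (reflexive (≡.cong ⟦_⟧ (≡.sym (ℤ.◃-inverse i)))) (◃-homo (sign i) ∣ i ∣)

    *ₛ-homo : ∀ s t → ⟦ s Sign.* t ⟧ₛ ≈ ⟦ s ⟧ₛ * ⟦ t ⟧ₛ
    *ₛ-homo Sign.+ t      = sym (*-identityˡ _)
    *ₛ-homo Sign.- Sign.+ = sym (*-identityʳ _)
    *ₛ-homo Sign.- Sign.- = begin
      1#                ≈⟨ sym (-‿involutive 1#) ⟩
      - (- 1#)          ≈⟨ -‿cong (sym (*-identityˡ _)) ⟩
      - (1# * - 1#)     ≈⟨ -‿distribˡ-* _ _ ⟩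
      - 1# * - 1#       ∎

    *-homo : ∀ i j → ⟦ i ℤ.* j ⟧ ≈ ⟦ i ⟧ * ⟦ j ⟧
    *-homo i j = begin
      ⟦ (sign i Sign.* sign j) ◃ (∣ i ∣ ℕ.* ∣ j ∣) ⟧             ≈⟨ ◃-homo (sign i Sign.* sign j) (∣ i ∣ ℕ.* ∣ j ∣) ⟩
      ⟦ sign i Sign.* sign j ⟧ₛ * ((∣ i ∣ ℕ.* ∣ j ∣) ×ₙ 1#)      ≈⟨ *-cong (*ₛ-homo (sign i) (sign j)) (×1-homo-* ∣ i ∣ ∣ j ∣) ⟩
      (⟦ sign i ⟧ₛ * ⟦ sign j ⟧ₛ) * ((∣ i ∣ ×ₙ 1#) * (∣ j ∣ ×ₙ 1#)) ≈⟨ interchange _ _ _ _ ⟩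
      (⟦ sign i ⟧ₛ * (∣ i ∣ ×ₙ 1#)) * (⟦ sign j ⟧ₛ * (∣ j ∣ ×ₙ 1#)) ≈⟨ sym (*-cong (sign-abs-homo i) (sign-abs-homo j)) ⟩
      ⟦ i ⟧ * ⟦ j ⟧                                             ∎
      where
      interchange : ∀ a b c d → (a * b) * (c * d) ≈ (a * c) * (b * d)
      interchange a b c d = begin
        (a * b) * (c * d) ≈⟨ *-assoc a b _ ⟩
        a * (b * (c * d)) ≈⟨ *-congˡ (sym (*-assoc b c d)) ⟩
        a * ((b * c) * d) ≈⟨ *-congˡ (*-congʳ (*-comm b c)) ⟩
        a * ((c * b) * d) ≈⟨ *-congˡ (*-assoc c b d) ⟩
        a * (c * (b * d)) ≈⟨ sym (*-assoc a c _) ⟩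
        (a * c) * (b * d) ∎

    ℤ-morphism : ℤ.+-*-rawRing ACR.-Raw-AlmostCommutative⟶ ACR.fromCommutativeRing R
    ℤ-morphism = record
      { ⟦_⟧ = ⟦_⟧ ; +-homo = +-homo ; *-homo = *-homo ; -‿homo = -‿homo
      ; 0-homo = refl ; 1-homo = +-identityʳ 1# }

    ⟦⟧-≟ : ∀ i j → Maybe (⟦ i ⟧ ≈ ⟦ j ⟧)
    ⟦⟧-≟ i j with i ℤ.≟ j
    ... | yes ≡.refl = just refl
    ... | no _       = nothing

  open Algebra.Solver.Ring ℤ.+-*-rawRing (ACR.fromCommutativeRing R) ℤ-morphism ⟦⟧-≟ public
    using (solve; _:+_; _:*_; :-_; _:-_; _:=_)

module FieldProperties (F : FiniteField) where

  open import Data.Nat as ℕ using (ℕ; suc; z≤n; s≤s)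
  open import Data.Nat.Properties using (≤-trans)
  open import Data.Fin using (Fin; zero; suc)
  open import Data.List using (length; allFin)
  import Data.List.Relation.Unary.Unique.Propositional.Properties as Unique
  open import Data.Product using (Σ; _,_; proj₁; proj₂)
  open import Data.Unit using (tt)
  open import Data.Empty using (⊥-elim)
  open import Relation.Nullary using (yes)
  open import Relation.Binary.PropositionalEquality using (_≡_; _≢_; refl; sym; trans; cong; module ≡-Reasoning)
  open import Algebra.Bundles using (CommutativeRing)
  open Counting

  open FiniteField F public

  commutativeRing : CommutativeRing _ _
  commutativeRing = record { isCommutativeRing = isCommutativeRing }

  open CommutativeRing commutativeRing public
    using (_-_; +-assoc; +-comm; +-identityˡ; +-identityʳ; -‿inverseʳ;
           *-assoc; *-comm; *-identityˡ; *-identityʳ; distribˡ; distribʳ; zeroˡ; zeroʳ; semiring)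
  open import Algebra.Properties.Ring (CommutativeRing.ring commutativeRing) public
    using (-0#≈0#; -‿distribˡ-*; x∙y⁻¹≈ε⇒x≈y; +-cancelʳ; -1*x≈-x)
  open IntegerRingSolver commutativeRing public
  open ≡-Reasoning

  1≢0 : 1# ≢ 0#
  1≢0 1≡0 = 0≢1 (sym 1≡0)

  inv : (x : Carrier) → x ≢ 0# → Carrier
  inv x x≢0 = proj₁ (inverse x x≢0)

  *-inverseʳ : ∀ x (x≢0 : x ≢ 0#) → x * inv x x≢0 ≡ 1#
  *-inverseʳ x x≢0 = proj₂ (inverse x x≢0)

  *-inverseˡ : ∀ x (x≢0 : x ≢ 0#) → inv x x≢0 * x ≡ 1#
  *-inverseˡ x x≢0 = trans (*-comm _ x) (*-inverseʳ x x≢0)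

  *-cancelˡ : ∀ {x} → x ≢ 0# → ∀ {a b} → x * a ≡ x * b → a ≡ b
  *-cancelˡ {x} x≢0 {a} {b} xa≡xb = begin
    a                      ≡⟨ sym (*-identityˡ a) ⟩
    1# * a                 ≡⟨ cong (_* a) (sym (*-inverseˡ x x≢0)) ⟩
    (x⁻¹ * x) * a          ≡⟨ *-assoc x⁻¹ x a ⟩
    x⁻¹ * (x * a)          ≡⟨ cong (x⁻¹ *_) xa≡xb ⟩
    x⁻¹ * (x * b)          ≡⟨ sym (*-assoc x⁻¹ x b) ⟩
    (x⁻¹ * x) * b          ≡⟨ cong (_* b) (*-inverseˡ x x≢0) ⟩
    1# * b                 ≡⟨ *-identityˡ b ⟩
    b                      ∎
    where x⁻¹ = inv x x≢0

  inv-*-cancelˡ : ∀ x (x≢0 : x ≢ 0#) a → inv x x≢0 * (x * a) ≡ a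
  inv-*-cancelˡ x x≢0 a = begin
    inv x x≢0 * (x * a)  ≡⟨ sym (*-assoc _ x a) ⟩
    (inv x x≢0 * x) * a  ≡⟨ cong (_* a) (*-inverseˡ x x≢0) ⟩
    1# * a               ≡⟨ *-identityˡ a ⟩
    a                    ∎

  *-cancelʳ : ∀ {x} → x ≢ 0# → ∀ {a b} → a * x ≡ b * x → a ≡ b
  *-cancelʳ {x} x≢0 {a} {b} ax≡bx = *-cancelˡ x≢0 (trans (*-comm x a) (trans ax≡bx (*-comm b x)))

  *-nonzero : ∀ {x y} → x ≢ 0# → y ≢ 0# → x * y ≢ 0#
  *-nonzero {x} x≢0 y≢0 xy≡0 = y≢0 (*-cancelˡ x≢0 (trans xy≡0 (sym (zeroʳ x))))

  x*y≢0⇒x≢0 : ∀ {x y} → x * y ≢ 0# → x ≢ 0#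
  x*y≢0⇒x≢0 {y = y} xy≢0 refl = xy≢0 (zeroˡ y)

  x*y≢0⇒y≢0 : ∀ {x y} → x * y ≢ 0# → y ≢ 0#
  x*y≢0⇒y≢0 {x} xy≢0 refl = xy≢0 (zeroʳ x)

  inv≢0 : ∀ x (x≢0 : x ≢ 0#) → inv x x≢0 ≢ 0#
  inv≢0 x x≢0 = x*y≢0⇒y≢0 (λ x*x⁻¹≡0 → 1≢0 (trans (sym (*-inverseʳ x x≢0)) x*x⁻¹≡0))

  x-y≡0⇒x≡y : ∀ {x y} → x - y ≡ 0# → x ≡ y
  x-y≡0⇒x≡y = x∙y⁻¹≈ε⇒x≈y _ _

  q : ℕ
  q = length elements

  2≤q : 2 ℕ.≤ q
  2≤q = length-≤-injection (allFin 2) (Unique.allFin⁺ 2) elements 0-or-1 (λ b _ → complete (0-or-1 b)) 0-or-1-injective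
    where
    0-or-1 : Fin 2 → Carrier
    0-or-1 zero    = 0#
    0-or-1 (suc _) = 1#
    0-or-1-injective : ∀ b b′ → _ → _ → 0-or-1 b ≡ 0-or-1 b′ → b ≡ b′
    0-or-1-injective zero          zero          _ _ _   = refl
    0-or-1-injective zero          (suc zero)    _ _ 0≡1 = ⊥-elim (0≢1 0≡1)
    0-or-1-injective (suc zero)    zero          _ _ 1≡0 = ⊥-elim (1≢0 1≡0)
    0-or-1-injective (suc zero)    (suc zero)    _ _ _   = refl

  q-nonZero : ℕ.NonZero q
  q-nonZero = ℕ.>-nonZero (≤-trans (s≤s z≤n) 2≤q)

module VectorEnumeration (F : FiniteField) where

  open import Data.Nat as ℕ using (ℕ; zero; suc; _^_)
  open import Data.Fin using (Fin)
  open import Data.Vec using (Vec; []; _∷_; lookup; tabulate)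
  open import Data.Vec.Properties using (∷-injective; tabulate∘lookup; tabulate-cong)
  open import Data.List using (List; []; _∷_; length; cartesianProductWith)
  open import Data.List.Membership.Propositional using (_∈_)
  open import Data.List.Membership.Propositional.Properties using (∈-cartesianProductWith⁺)
  open import Data.List.Relation.Unary.Any using (here; any?; satisfied)
  import Data.List.Relation.Unary.Any as Any
  open import Data.List.Relation.Unary.Unique.Propositional using (Unique)
  import Data.List.Relation.Unary.Unique.Propositional.Properties as Unique
  open import Data.List.Relation.Unary.All using ([])
  open import Data.List.Relation.Unary.AllPairs using ([]; _∷_)
  open import Data.Product using (Σ; _,_)
  open import Relation.Nullary using (Dec; yes; no)
  open import Relation.Unary using (Decidable)
  open import Relation.Binary.PropositionalEquality using (_≡_; _≗_; refl; sym; trans; cong; subst)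
  open FieldProperties F
  open import Function.Bundles using (_⇔_; Equivalence)
  open Counting

  vectors : (k : ℕ) → List (Vec Carrier k)
  vectors zero    = [] ∷ []
  vectors (suc k) = cartesianProductWith _∷_ elements (vectors k)

  ∈-vectors : ∀ {k} (v : Vec Carrier k) → v ∈ vectors k
  ∈-vectors []      = here refl
  ∈-vectors (x ∷ v) = ∈-cartesianProductWith⁺ _∷_ (complete x) (∈-vectors v)

  vectors-unique : ∀ k → Unique (vectors k)
  vectors-unique zero    = [] ∷ []
  vectors-unique (suc k) = Unique.cartesianProductWith⁺ _∷_ ∷-injective unique (vectors-unique k)

  length-vectors : ∀ k → length (vectors k) ≡ q ^ k
  length-vectors zero    = refl
  length-vectors (suc k) = trans (length-cartesianProductWith _∷_ elements (vectors k)) (cong (q ℕ.*_) (length-vectors k))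

  ≗⇒≡ : ∀ {k} {v w : Vec Carrier k} → lookup v ≗ lookup w → v ≡ w
  ≗⇒≡ {v = v} {w} v≗w = trans (sym (tabulate∘lookup v)) (trans (tabulate-cong v≗w) (tabulate∘lookup w))

  ∃? : {P : Carrier → Set} → Decidable P → Dec (Σ Carrier P)
  ∃? {P} P? with any? P? elements
  ... | yes some = yes (satisfied some)
  ... | no none  = no (λ (c , pc) → none (Any.map (λ { refl → pc }) (complete c)))

  count-vectors-bijection : ∀ {k} {P Q : Vec Carrier k → Set} (P? : Decidable P) (Q? : Decidable Q)
    (f g : Vec Carrier k → Vec Carrier k) → (∀ v → g (f v) ≡ v) → (∀ v → f (g v) ≡ v) →
    (∀ v → P v ⇔ Q (f v)) → count P? (vectors k) ≡ count Q? (vectors k)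
  count-vectors-bijection {k} {Q = Q} P? Q? f g gf fg P⇔Qf =
    count-≡-bijection P? Q? (vectors k) (vectors-unique k) ∈-vectors (vectors k) (vectors-unique k) ∈-vectors f g gf fg
      (λ v → Equivalence.to (P⇔Qf v)) (λ v qv → Equivalence.from (P⇔Qf (g v)) (subst Q (sym (fg v)) qv))

module LinearAlgebra (F : FiniteField) (n : ℕ) where
  open import Data.Nat using (ℕ; zero; suc)

  open import Data.Fin as Fin using (Fin; zero; suc; punchIn)
  open import Data.Fin.Properties using (punchInᵢ≢i; any?)
  open import Data.Product using (Σ; _×_; _,_)
  open import Relation.Nullary using (Dec; ¬_)
  open import Relation.Nullary.Decidable using (¬?; decidable-stable)
  import Data.List as List
  open import Data.Empty using (⊥-elim)
  open import Relation.Nullary using (yes; no)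
  open import Relation.Binary.PropositionalEquality using (_≡_; _≢_; _≗_; refl; sym; trans; cong; cong₂; module ≡-Reasoning)
  open FieldProperties F
  open MatrixDefs F n
  open import Algebra.Properties.Semiring.Sum semiring using (sum; ∑-distrib-+; ∑-comm; *-distribˡ-sum; sum-remove; sum-cong-≗; sum-replicate-zero)
  open ≡-Reasoning

  sumIdx≡sum : ∀ f → sumIdx f ≡ sum f
  sumIdx≡sum f = foldr-tabulate (λ i → i)
    where
    foldr-tabulate : ∀ {k} (g : Fin k → Idx) → List.foldr (λ i acc → f i + acc) 0# (List.tabulate g) ≡ sum (λ i → f (g i))
    foldr-tabulate {zero}  g = refl
    foldr-tabulate {suc k} g = cong (f (g zero) +_) (foldr-tabulate (λ i → g (suc i)))

  sumIdx-cong : ∀ {f g} → f ≗ g → sumIdx f ≡ sumIdx g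
  sumIdx-cong {f} {g} f≗g = trans (sumIdx≡sum f) (trans (sum-cong-≗ f≗g) (sym (sumIdx≡sum g)))

  sumIdx-+ : ∀ f g → sumIdx (λ i → f i + g i) ≡ sumIdx f + sumIdx g
  sumIdx-+ f g = trans (sumIdx≡sum _) (trans (∑-distrib-+ f g) (sym (cong₂ _+_ (sumIdx≡sum f) (sumIdx≡sum g))))

  sumIdx-*ˡ : ∀ c f → sumIdx (λ i → c * f i) ≡ c * sumIdx f
  sumIdx-*ˡ c f = trans (sumIdx≡sum _) (trans (sym (*-distribˡ-sum c f)) (cong (c *_) (sym (sumIdx≡sum f))))

  sumIdx-comm : ∀ f → sumIdx (λ i → sumIdx (f i)) ≡ sumIdx (λ j → sumIdx (λ i → f i j))
  sumIdx-comm f = begin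
    sumIdx (λ i → sumIdx (f i))          ≡⟨ sumIdx-cong (λ i → sumIdx≡sum (f i)) ⟩
    sumIdx (λ i → sum (f i))             ≡⟨ sumIdx≡sum _ ⟩
    sum (λ i → sum (f i))                ≡⟨ ∑-comm f ⟩
    sum (λ j → sum (λ i → f i j))        ≡⟨ sym (sumIdx≡sum _) ⟩
    sumIdx (λ j → sum (λ i → f i j))     ≡⟨ sumIdx-cong (λ j → sym (sumIdx≡sum _)) ⟩
    sumIdx (λ j → sumIdx (λ i → f i j))  ∎

  sumIdx-zero : ∀ f → (∀ i → f i ≡ 0#) → sumIdx f ≡ 0#
  sumIdx-zero f f≡0 = trans (sumIdx≡sum f) (trans (sum-cong-≗ f≡0) (sum-replicate-zero (suc n)))

  sumIdx-single : ∀ i f → (∀ j → j ≢ i → f j ≡ 0#) → sumIdx f ≡ f i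
  sumIdx-single i f vanishes = begin
    sumIdx f                                ≡⟨ sumIdx≡sum f ⟩
    sum f                                   ≡⟨ sum-remove {i = i} f ⟩
    f i + sum (λ k → f (punchIn i k))       ≡⟨ cong (f i +_) (trans (sum-cong-≗ (λ k → vanishes _ (punchInᵢ≢i i k))) (sum-replicate-zero n)) ⟩
    f i + 0#                                ≡⟨ +-identityʳ (f i) ⟩
    f i                                     ∎

  infixr 7 _*ᵥ_
  _*ᵥ_ : Mat → Col → Col
  (M *ᵥ x) i = sumIdx (λ j → M i j * x j)

  δ : Idx → Idx → Carrier
  δ i j with i Fin.≟ j
  ... | yes _ = 1#
  ... | no _  = 0#

  δ-refl : ∀ i → δ i i ≡ 1#
  δ-refl i with i Fin.≟ i
  ... | yes _   = refl
  ... | no i≢i  = ⊥-elim (i≢i refl)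

  δ-≢ : ∀ {i j : Idx} → i ≢ j → δ i j ≡ 0#
  δ-≢ {i} {j} i≢j with i Fin.≟ j
  ... | yes i≡j = ⊥-elim (i≢j i≡j)
  ... | no _    = refl

  sumIdx-δˡ : ∀ i (f : Idx → Carrier) → sumIdx (λ j → δ i j * f j) ≡ f i
  sumIdx-δˡ i f = begin
    sumIdx (λ j → δ i j * f j) ≡⟨ sumIdx-single i (λ j → δ i j * f j) (λ j j≢i → trans (cong (_* f j) (δ-≢ (λ i≡j → j≢i (sym i≡j)))) (zeroˡ (f j))) ⟩
    δ i i * f i                ≡⟨ cong (_* f i) (δ-refl i) ⟩
    1# * f i                   ≡⟨ *-identityˡ (f i) ⟩
    f i                        ∎

  sumIdx-δʳ : ∀ i (f : Idx → Carrier) → sumIdx (λ j → f j * δ j i) ≡ f i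
  sumIdx-δʳ i f = begin
    sumIdx (λ j → f j * δ j i) ≡⟨ sumIdx-single i (λ j → f j * δ j i) (λ j j≢i → trans (cong (f j *_) (δ-≢ j≢i)) (zeroʳ (f j))) ⟩
    f i * δ i i                ≡⟨ cong (f i *_) (δ-refl i) ⟩
    f i * 1#                   ≡⟨ *-identityʳ (f i) ⟩
    f i                        ∎

  rowCol-cong : ∀ {ξ ξ′ : Row} {x x′ : Col} → ξ ≗ ξ′ → x ≗ x′ → rowCol ξ x ≡ rowCol ξ′ x′
  rowCol-cong ξ≗ξ′ x≗x′ = sumIdx-cong (λ i → cong₂ _*_ (ξ≗ξ′ i) (x≗x′ i))

  rowCol-zeroʳ : ∀ (ξ : Row) {x : Col} → (∀ i → x i ≡ 0#) → rowCol ξ x ≡ 0#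
  rowCol-zeroʳ ξ {x} x≡0 = sumIdx-zero _ (λ i → trans (cong (ξ i *_) (x≡0 i)) (zeroʳ (ξ i)))

  rowCol-zeroˡ : ∀ {ξ : Row} (x : Col) → (∀ i → ξ i ≡ 0#) → rowCol ξ x ≡ 0#
  rowCol-zeroˡ {ξ} x ξ≡0 = sumIdx-zero _ (λ i → trans (cong (_* x i) (ξ≡0 i)) (zeroˡ (x i)))

  rowCol-linearʳ : ∀ (ξ : Row) (y x : Col) c → rowCol ξ (λ i → y i + c * x i) ≡ rowCol ξ y + c * rowCol ξ x
  rowCol-linearʳ ξ y x c = begin
    sumIdx (λ i → ξ i * (y i + c * x i))            ≡⟨ sumIdx-cong (λ i → solve 4 (λ a b c d → a :* (b :+ c :* d) := a :* b :+ c :* (a :* d)) refl (ξ i) (y i) c (x i)) ⟩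
    sumIdx (λ i → ξ i * y i + c * (ξ i * x i))      ≡⟨ sumIdx-+ _ _ ⟩
    rowCol ξ y + sumIdx (λ i → c * (ξ i * x i))     ≡⟨ cong (rowCol ξ y +_) (sumIdx-*ˡ c _) ⟩
    rowCol ξ y + c * rowCol ξ x                     ∎

  rowCol-scaleʳ : ∀ (ξ : Row) (x : Col) c → rowCol ξ (λ i → c * x i) ≡ c * rowCol ξ x
  rowCol-scaleʳ ξ x c = trans (sumIdx-cong (λ i → solve 3 (λ a b c → a :* (b :* c) := b :* (a :* c)) refl (ξ i) c (x i))) (sumIdx-*ˡ c _)

  *ᵥ-cong : ∀ (M : Mat) {x x′ : Col} → x ≗ x′ → M *ᵥ x ≗ M *ᵥ x′
  *ᵥ-cong M x≗x′ i = rowCol-cong {M i} (λ _ → refl) x≗x′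

  *ᵥ-linear : ∀ (M : Mat) (y x : Col) c → M *ᵥ (λ i → y i + c * x i) ≗ (λ i → (M *ᵥ y) i + c * (M *ᵥ x) i)
  *ᵥ-linear M y x c i = rowCol-linearʳ (M i) y x c

  *ᵥ-zero : ∀ (M : Mat) {x : Col} → (∀ i → x i ≡ 0#) → ∀ i → (M *ᵥ x) i ≡ 0#
  *ᵥ-zero M x≡0 i = rowCol-zeroʳ (M i) x≡0

  Tr-outer : ∀ {A : Mat} {x : Col} {ξ : Row} → A ≐ outer x ξ → Tr A ≡ rowCol ξ x
  Tr-outer {x = x} {ξ} A≐xξ = sumIdx-cong (λ i → trans (A≐xξ i i) (*-comm (x i) (ξ i)))

  Tr-·-outer : ∀ {A : Mat} {x : Col} {ξ : Row} (M : Mat) → A ≐ outer x ξ → Tr (A · M) ≡ rowCol ξ (M *ᵥ x)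
  Tr-·-outer {A} {x} {ξ} M A≐xξ = begin
    sumIdx (λ i → sumIdx (λ k → A i k * M k i))               ≡⟨ sumIdx-cong (λ i → sumIdx-cong (λ k → cong (_* M k i) (A≐xξ i k))) ⟩
    sumIdx (λ i → sumIdx (λ k → (x i * ξ k) * M k i))         ≡⟨ sumIdx-comm _ ⟩
    sumIdx (λ k → sumIdx (λ i → (x i * ξ k) * M k i))         ≡⟨ sumIdx-cong (λ k → sumIdx-cong (λ i → solve 3 (λ a b c → (a :* b) :* c := b :* (c :* a)) refl (x i) (ξ k) (M k i))) ⟩
    sumIdx (λ k → sumIdx (λ i → ξ k * (M k i * x i)))         ≡⟨ sumIdx-cong (λ k → sumIdx-*ˡ (ξ k) _) ⟩
    rowCol ξ (M *ᵥ x)                                          ∎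

  Tr-scale : ∀ {A B : Mat} c → B ≐ (λ i j → c * A i j) → Tr B ≡ c * Tr A
  Tr-scale c B≐cA = trans (sumIdx-cong (λ i → B≐cA i i)) (sumIdx-*ˡ c _)

  Tr-·-scale : ∀ {A B : Mat} c (M : Mat) → B ≐ (λ i j → c * A i j) → Tr (B · M) ≡ c * Tr (A · M)
  Tr-·-scale {A} {B} c M B≐cA = begin
    sumIdx (λ i → sumIdx (λ k → B i k * M k i))           ≡⟨ sumIdx-cong (λ i → sumIdx-cong (λ k → trans (cong (_* M k i) (B≐cA i k)) (*-assoc c (A i k) (M k i)))) ⟩
    sumIdx (λ i → sumIdx (λ k → c * (A i k * M k i)))     ≡⟨ sumIdx-cong (λ i → sumIdx-*ˡ c _) ⟩
    sumIdx (λ i → c * sumIdx (λ k → A i k * M k i))       ≡⟨ sumIdx-*ˡ c _ ⟩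
    c * Tr (A · M)                                         ∎

  Tr-·-shift : ∀ (A M N : Mat) a → M ≐ (λ i j → N i j + a * δ i j) → Tr (A · M) ≡ Tr (A · N) + a * Tr A
  Tr-·-shift A M N a M≐N+aI = begin
    sumIdx (λ i → sumIdx (λ k → A i k * M k i))
      ≡⟨ sumIdx-cong (λ i → sumIdx-cong (λ k → trans (cong (A i k *_) (M≐N+aI k i))
           (solve 4 (λ x n a d → x :* (n :+ a :* d) := x :* n :+ a :* (x :* d)) refl (A i k) (N k i) a (δ k i)))) ⟩
    sumIdx (λ i → sumIdx (λ k → A i k * N k i + a * (A i k * δ k i)))
      ≡⟨ sumIdx-cong (λ i → trans (sumIdx-+ _ _) (cong (sumIdx (λ k → A i k * N k i) +_) (trans (sumIdx-*ˡ a _) (cong (a *_) (sumIdx-δʳ i (A i)))))) ⟩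
    sumIdx (λ i → sumIdx (λ k → A i k * N k i) + a * A i i)
      ≡⟨ sumIdx-+ _ _ ⟩
    Tr (A · N) + sumIdx (λ i → a * A i i)
      ≡⟨ cong (Tr (A · N) +_) (sumIdx-*ˡ a _) ⟩
    Tr (A · N) + a * Tr A ∎

  nonzero? : (x : Idx → Carrier) → Dec (NonzeroVec x)
  nonzero? x = any? (λ i → ¬? (x i ≟ 0#))

  ¬nonzero⇒zero : ∀ {x : Idx → Carrier} → ¬ NonzeroVec x → ∀ i → x i ≡ 0#
  ¬nonzero⇒zero {x} x≡0 i = decidable-stable (x i ≟ 0#) (λ xi≢0 → x≡0 (i , xi≢0))

  rowCol≢0⇒nonzeroˡ : ∀ {ξ : Row} (x : Col) → rowCol ξ x ≢ 0# → NonzeroVec ξ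
  rowCol≢0⇒nonzeroˡ {ξ} x ξx≢0 = decidable-stable (nonzero? ξ) (λ ξ≡0 → ξx≢0 (rowCol-zeroˡ x (¬nonzero⇒zero ξ≡0)))

  rowCol≢0⇒nonzeroʳ : ∀ (ξ : Row) {x : Col} → rowCol ξ x ≢ 0# → NonzeroVec x
  rowCol≢0⇒nonzeroʳ ξ {x} ξx≢0 = decidable-stable (nonzero? x) (λ x≡0 → ξx≢0 (rowCol-zeroʳ ξ (¬nonzero⇒zero x≡0)))

  outer-cancel : ∀ {v v′ : Col} {w w′ : Row} {i j} → outer v w ≐ outer v′ w′ →
                 v i ≡ v′ i → v i ≢ 0# → w j ≡ w′ j → w j ≢ 0# → v ≗ v′ × w ≗ w′
  outer-cancel {v} {v′} {w} {w′} {i} {j} vw≐v′w′ vi≡v′i vi≢0 wj≡w′j wj≢0 =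
    (λ r → *-cancelʳ wj≢0 (trans (vw≐v′w′ r j) (cong (v′ r *_) (sym wj≡w′j)))) ,
    (λ s → *-cancelˡ vi≢0 (trans (vw≐v′w′ i s) (cong (_* w′ s) (sym vi≡v′i))))

  samePoint-common : ∀ {A B Y} → SamePoint A Y → SamePoint B Y → SamePoint A B
  samePoint-common {A} {B} {Y} (c , c≢0 , Y≐cA) (d , d≢0 , Y≐dB) = inv d d≢0 * c , *-nonzero (inv≢0 d d≢0) c≢0 , λ i j → begin
    B i j                     ≡⟨ sym (*-identityˡ _) ⟩
    1# * B i j                ≡⟨ cong (_* B i j) (sym (*-inverseˡ d d≢0)) ⟩
    (d⁻¹ * d) * B i j         ≡⟨ *-assoc d⁻¹ d (B i j) ⟩
    d⁻¹ * (d * B i j)         ≡⟨ cong (d⁻¹ *_) (trans (sym (Y≐dB i j)) (Y≐cA i j)) ⟩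
    d⁻¹ * (c * A i j)         ≡⟨ sym (*-assoc d⁻¹ c (A i j)) ⟩
    (d⁻¹ * c) * A i j         ∎
    where d⁻¹ = inv d d≢0

  rowCol-*ᵥ≢0⇒nonzero : ∀ (ξ : Row) (M : Mat) {x : Col} → rowCol ξ (M *ᵥ x) ≢ 0# → NonzeroVec x
  rowCol-*ᵥ≢0⇒nonzero ξ M {x} ξMx≢0 =
    decidable-stable (nonzero? x) (λ x≡0 → ξMx≢0 (rowCol-zeroʳ ξ (*ᵥ-zero M (¬nonzero⇒zero x≡0))))

  Eigenspace : Mat → Carrier → Col → Set
  Eigenspace M a x = ∀ i → (M *ᵥ x) i ≡ a * x i

  Eigenvector : Mat → Col → Set
  Eigenvector M x = Σ Carrier λ a → Eigenspace M a x

module Flags (F : FiniteField) (n : ℕ) where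
  open import Data.Nat using (ℕ; suc)

  open import Data.Vec using (Vec; lookup)
  open import Data.List using (List; cartesianProduct)
  open import Data.List.Membership.Propositional using (_∈_)
  open import Data.List.Membership.Propositional.Properties using (∈-cartesianProduct⁺)
  open import Data.List.Relation.Unary.Unique.Propositional using (Unique)
  import Data.List.Relation.Unary.Unique.Propositional.Properties as Unique
  open import Data.Product using (_×_; _,_)
  open import Relation.Nullary.Decidable using (_×-dec_; ¬?)
  open import Relation.Unary using (Decidable)
  open import Relation.Binary.PropositionalEquality using (_≡_; _≢_)
  open FieldProperties F
  open LinearAlgebra F n
  open VectorEnumeration F
  open MatrixDefs F n

  V : Set
  V = Vec Carrier (suc n)

  allV : List V
  allV = vectors (suc n)

  flags : List (V × V)
  flags = cartesianProduct allV allV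

  ∈-flags : ∀ p → p ∈ flags
  ∈-flags (v , w) = ∈-cartesianProduct⁺ (∈-vectors v) (∈-vectors w)

  flags-unique : Unique flags
  flags-unique = Unique.cartesianProduct⁺ (vectors-unique (suc n)) (vectors-unique (suc n))

  Separates : Col → Col → V → Set
  Separates x y w = rowCol (lookup w) x ≡ 0# × rowCol (lookup w) y ≢ 0#

  separates? : ∀ x y → Decidable (Separates x y)
  separates? x y w = (rowCol (lookup w) x ≟ 0#) ×-dec ¬? (rowCol (lookup w) y ≟ 0#)

  OffHyperplane : Mat → V × V → Set
  OffHyperplane M (v , w) = Separates (lookup v) (M *ᵥ lookup v) w

  offHyperplane? : (M : Mat) → Decidable (OffHyperplane M)
  offHyperplane? M (v , w) = separates? (lookup v) (M *ᵥ lookup v) w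

module WeightCount (F : FiniteField) (n : ℕ) (Npts : ℕ) (Xs : Fin Npts → MatrixDefs.Mat F n)
                   (Λ₁ : MatrixDefs.IsProjSystemΛ₁ F n Npts Xs) where
  open import Data.Nat as ℕ using (ℕ; zero; suc)
  open import Data.Fin using (Fin)

  open import Data.Nat.Properties using (≤-antisym)
  open import Data.Fin.Properties using (all?)
  open import Data.Vec using (Vec; lookup; tabulate)
  open import Data.Vec.Properties using (lookup∘tabulate)
  open import Data.List using (List; allFin; map; cartesianProduct)
  open import Data.Nat.ListAction using (sum)
  open import Data.List.Membership.Propositional using (_∈_)
  open import Data.List.Membership.Propositional.Properties using (∈-allFin; ∈-cartesianProduct⁺)
  open import Data.List.Relation.Unary.Unique.Propositional using (Unique)
  import Data.List.Relation.Unary.Unique.Propositional.Properties as Unique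
  open import Data.Product using (Σ; ∃; _×_; _,_; proj₁; proj₂)
  open import Relation.Nullary using (¬_; Dec; yes; no)
  open import Relation.Nullary.Decidable using (_×-dec_; ¬?; decidable-stable)
  open import Relation.Unary using (Decidable)
  open import Function.Bundles using (_⇔_; mk⇔; Equivalence)
  open import Relation.Binary.PropositionalEquality using (_≡_; _≢_; _≗_; refl; sym; trans; cong; cong₂; module ≡-Reasoning)
  open FieldProperties F
  open Counting
  open LinearAlgebra F n
  open VectorEnumeration F
  open MatrixDefs F n
  open Flags F n
  open ≡-Reasoning

  NonzeroPair : Carrier × Carrier → Set
  NonzeroPair (a , b) = a ≢ 0# × b ≢ 0#

  nonzeroPair? : Decidable NonzeroPair
  nonzeroPair? (a , b) = ¬? (a ≟ 0#) ×-dec ¬? (b ≟ 0#)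

  #nonzeroPairs : ℕ
  #nonzeroPairs = count nonzeroPair? (cartesianProduct elements elements)

  Represents : Fin Npts → V × V → Set
  Represents k (v , w) = SamePoint (Xs k) (outer (lookup v) (lookup w))

  represents? : ∀ k → Decidable (Represents k)
  represents? k (v , w) = ∃? (λ c → ¬? (c ≟ 0#) ×-dec ≐? (outer (lookup v) (lookup w)) (λ i j → c * Xs k i j))
    where
    ≐? : (A B : Mat) → Dec (A ≐ B)
    ≐? A B = all? (λ i → all? (λ j → A i j ≟ B i j))

  Tr-Λ₁ : ∀ k → Tr (Xs k) ≡ 0#
  Tr-Λ₁ k = let (x , ξ , _ , _ , ξx≡0 , X≐xξ) = proj₁ Λ₁ k in trans (Tr-outer X≐xξ) ξx≡0

  offHyperplane⇔codeword≢0 : ∀ M {k} p → Represents k p → OffHyperplane M p ⇔ (codeword Xs M k ≢ 0#)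
  offHyperplane⇔codeword≢0 M {k} (v , w) (c , c≢0 , vw≐cX) = mk⇔
    (λ (_ , wMv≢0) cₖ≡0 → wMv≢0 (trans wMv≡c·cₖ (trans (cong (c *_) cₖ≡0) (zeroʳ c))))
    (λ cₖ≢0 → wv≡0 , λ wMv≡0 → *-nonzero c≢0 cₖ≢0 (trans (sym wMv≡c·cₖ) wMv≡0))
    where
    wv≡0 : rowCol (lookup w) (lookup v) ≡ 0#
    wv≡0 = begin
      rowCol (lookup w) (lookup v)     ≡⟨ sym (Tr-outer (λ _ _ → refl)) ⟩
      Tr (outer (lookup v) (lookup w)) ≡⟨ Tr-scale c vw≐cX ⟩
      c * Tr (Xs k)                    ≡⟨ cong (c *_) (Tr-Λ₁ k) ⟩
      c * 0#                           ≡⟨ zeroʳ c ⟩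
      0#                               ∎
    wMv≡c·cₖ : rowCol (lookup w) (M *ᵥ lookup v) ≡ c * codeword Xs M k
    wMv≡c·cₖ = trans (sym (Tr-·-outer M (λ _ _ → refl))) (Tr-·-scale c M vw≐cX)

  offHyperplane⇒represented : ∀ M p → OffHyperplane M p → Σ (Fin Npts) λ k → k ∈ allFin Npts × Represents k p
  offHyperplane⇒represented M (v , w) (wv≡0 , wMv≢0) =
    let (k , same) = proj₁ (proj₂ Λ₁) (outer (lookup v) (lookup w))
                       (lookup v , lookup w , rowCol-*ᵥ≢0⇒nonzero (lookup w) M wMv≢0 , rowCol≢0⇒nonzeroˡ _ wMv≢0 , wv≡0 , λ _ _ → refl)
    in k , ∈-allFin k , same

  represents-unique : ∀ p k l → Represents k p → Represents l p → k ≡ l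
  represents-unique p k l repₖ repₗ = proj₂ (proj₂ Λ₁) k l (samePoint-common repₖ repₗ)

  representatives-count : ∀ k → count (represents? k) flags ≡ #nonzeroPairs
  representatives-count k with proj₁ Λ₁ k
  ... | (x , ξ , (i₀ , xᵢ₀≢0) , (j₀ , ξⱼ₀≢0) , _ , X≐xξ) =
    ≤-antisym (count-≤-injection (represents? k) nonzeroPair? flags flags-unique _ ∈-pairs coordinates coordinates-nonzero coordinates-injective)
              (count-≤-injection nonzeroPair? (represents? k) _ pairs-unique flags ∈-flags scale scale-represents scale-injective)
    where
    X = Xs k
    Xᵢ₀ⱼ₀≢0 : X i₀ j₀ ≢ 0#
    Xᵢ₀ⱼ₀≢0 X≡0 = *-nonzero xᵢ₀≢0 ξⱼ₀≢0 (trans (sym (X≐xξ i₀ j₀)) X≡0)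

    ∈-pairs : ∀ p → p ∈ cartesianProduct elements elements
    ∈-pairs (a , b) = ∈-cartesianProduct⁺ (complete a) (complete b)
    pairs-unique : Unique (cartesianProduct elements elements)
    pairs-unique = Unique.cartesianProduct⁺ unique unique

    scale : Carrier × Carrier → V × V
    scale (a , b) = tabulate (λ i → a * x i) , tabulate (λ j → b * ξ j)

    scale-represents : ∀ p → NonzeroPair p → Represents k (scale p)
    scale-represents (a , b) (a≢0 , b≢0) = a * b , *-nonzero a≢0 b≢0 , λ i j → begin
      lookup (tabulate (λ i → a * x i)) i * lookup (tabulate (λ j → b * ξ j)) j ≡⟨ cong₂ _*_ (lookup∘tabulate (λ i → a * x i) i) (lookup∘tabulate (λ j → b * ξ j) j) ⟩
      (a * x i) * (b * ξ j)                                                      ≡⟨ solve 4 (λ a x b ξ → (a :* x) :* (b :* ξ) := (a :* b) :* (x :* ξ)) refl a (x i) b (ξ j) ⟩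
      (a * b) * (x i * ξ j)                                                      ≡⟨ cong ((a * b) *_) (sym (X≐xξ i j)) ⟩
      (a * b) * X i j                                                            ∎

    scale-injective : ∀ p p′ → NonzeroPair p → NonzeroPair p′ → scale p ≡ scale p′ → p ≡ p′
    scale-injective (a , b) (a′ , b′) _ _ eq = cong₂ _,_
      (*-cancelʳ xᵢ₀≢0 (trans (sym (lookup∘tabulate (λ i → a * x i) i₀))
                         (trans (cong (λ p → lookup (proj₁ p) i₀) eq) (lookup∘tabulate (λ i → a′ * x i) i₀))))
      (*-cancelʳ ξⱼ₀≢0 (trans (sym (lookup∘tabulate (λ j → b * ξ j) j₀))
                         (trans (cong (λ p → lookup (proj₂ p) j₀) eq) (lookup∘tabulate (λ j → b′ * ξ j) j₀))))

    coordinates : V × V → Carrier × Carrier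
    coordinates (v , w) = lookup v i₀ * inv (x i₀) xᵢ₀≢0 , lookup w j₀ * inv (ξ j₀) ξⱼ₀≢0

    pivot-nonzero : ∀ v w → Represents k (v , w) → lookup v i₀ * lookup w j₀ ≢ 0#
    pivot-nonzero v w (c , c≢0 , vw≐cX) vw≡0 = *-nonzero c≢0 Xᵢ₀ⱼ₀≢0 (trans (sym (vw≐cX i₀ j₀)) vw≡0)

    coordinates-nonzero : ∀ p → Represents k p → NonzeroPair (coordinates p)
    coordinates-nonzero (v , w) rep =
      *-nonzero (x*y≢0⇒x≢0 (pivot-nonzero v w rep)) (inv≢0 _ xᵢ₀≢0) , *-nonzero (x*y≢0⇒y≢0 (pivot-nonzero v w rep)) (inv≢0 _ ξⱼ₀≢0)

    coordinates-injective : ∀ p p′ → Represents k p → Represents k p′ → coordinates p ≡ coordinates p′ → p ≡ p′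
    coordinates-injective (v , w) (v′ , w′) rep@(c , _ , vw≐cX) (c′ , _ , v′w′≐c′X) eq =
      cong₂ _,_ (≗⇒≡ (proj₁ same-factors)) (≗⇒≡ (proj₂ same-factors))
      where
      vᵢ₀≡ : lookup v i₀ ≡ lookup v′ i₀
      vᵢ₀≡ = *-cancelʳ (inv≢0 _ xᵢ₀≢0) (cong proj₁ eq)
      wⱼ₀≡ : lookup w j₀ ≡ lookup w′ j₀
      wⱼ₀≡ = *-cancelʳ (inv≢0 _ ξⱼ₀≢0) (cong proj₂ eq)
      c≡c′ : c ≡ c′
      c≡c′ = *-cancelʳ Xᵢ₀ⱼ₀≢0 (trans (sym (vw≐cX i₀ j₀)) (trans (cong₂ _*_ vᵢ₀≡ wⱼ₀≡) (v′w′≐c′X i₀ j₀)))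
      same-outer : outer (lookup v) (lookup w) ≐ outer (lookup v′) (lookup w′)
      same-outer i j = trans (vw≐cX i j) (trans (cong (_* X i j) c≡c′) (sym (v′w′≐c′X i j)))
      same-factors = outer-cancel same-outer vᵢ₀≡ (x*y≢0⇒x≢0 (pivot-nonzero v w rep)) wⱼ₀≡ (x*y≢0⇒y≢0 (pivot-nonzero v w rep))

  offHyperplane-count : ∀ M → count (offHyperplane? M) flags ≡ weight (codeword Xs M) ℕ.* #nonzeroPairs
  offHyperplane-count M = begin
    count (offHyperplane? M) flags
      ≡⟨ count-partition (offHyperplane? M) represents? flags (allFin Npts) (Unique.allFin⁺ Npts)
           (offHyperplane⇒represented M) (λ p _ → represents-unique p) ⟩
    sum (map (λ k → count (λ p → offHyperplane? M p ×-dec represents? k p) flags) (allFin Npts))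
      ≡⟨ sum-indicator (λ k → ¬? (codeword Xs M k ≟ 0#)) #nonzeroPairs _ (allFin Npts) nonzero-fibre zero-fibre ⟩
    weight (codeword Xs M) ℕ.* #nonzeroPairs ∎
    where
    nonzero-fibre : ∀ k → _ → codeword Xs M k ≢ 0# → count (λ p → offHyperplane? M p ×-dec represents? k p) flags ≡ #nonzeroPairs
    nonzero-fibre k _ cₖ≢0 = trans (count-cong _ (represents? k) flags (λ _ _ → proj₂) (λ p _ rep → Equivalence.from (offHyperplane⇔codeword≢0 M p rep) cₖ≢0 , rep))
                                   (representatives-count k)
    zero-fibre : ∀ k → _ → ¬ (codeword Xs M k ≢ 0#) → count (λ p → offHyperplane? M p ×-dec represents? k p) flags ≡ 0
    zero-fibre k _ cₖ≡0 = count-none _ flags (λ p _ (off , rep) → cₖ≡0 (Equivalence.to (offHyperplane⇔codeword≢0 M p rep) off))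

module NonEigenvectorFibres (F : FiniteField) (m : ℕ) where
  open import Data.Nat as ℕ using (ℕ; zero; suc)

  open import Data.Fin as Fin using (Fin; zero; suc)
  open import Data.Fin.Properties using (all?)
  import Data.Fin.Permutation.Components as Perm
  open import Data.Vec using (Vec; _∷_; lookup; tabulate; replicate; _[_]≔_)
  open import Data.Vec.Properties using (lookup∘tabulate; lookup∘update; lookup∘update′)
  open import Data.List using (List; map; cartesianProductWith)
  open import Data.Nat.ListAction using (sum)
  open import Data.Product using (Σ; _×_; _,_; proj₁; proj₂)
  open import Data.Empty using (⊥-elim)
  open import Function.Bundles using (_⇔_; mk⇔; Equivalence)
  open import Relation.Nullary using (¬_; Dec; yes; no)
  open import Relation.Nullary.Decidable using (_×-dec_; ¬?; dec-true; dec-false; decidable-stable)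
  open import Relation.Unary using (Decidable)
  open import Relation.Binary.PropositionalEquality using (_≡_; _≢_; _≗_; refl; sym; trans; cong; cong₂; subst; module ≡-Reasoning)
  open FieldProperties F
  open Counting
  open VectorEnumeration F
  open MatrixDefs F (suc m)
  open LinearAlgebra F (suc m)
  open Flags F (suc m)
  open ≡-Reasoning

  rowCol-update : ∀ (w : V) i a (u : Col) → rowCol (lookup (w [ i ]≔ a)) u ≡ rowCol (lookup w) u + (a - lookup w i) * u i
  rowCol-update w i a u = begin
    rowCol (lookup (w [ i ]≔ a)) u                                     ≡⟨ sumIdx-cong termwise ⟩
    sumIdx (λ r → lookup w r * u r + ((a - lookup w i) * u r) * δ r i) ≡⟨ sumIdx-+ _ _ ⟩
    rowCol (lookup w) u + sumIdx (λ r → ((a - lookup w i) * u r) * δ r i) ≡⟨ cong (rowCol (lookup w) u +_) (sumIdx-δʳ i (λ r → (a - lookup w i) * u r)) ⟩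
    rowCol (lookup w) u + (a - lookup w i) * u i                      ∎
    where
    termwise : ∀ r → lookup (w [ i ]≔ a) r * u r ≡ lookup w r * u r + ((a - lookup w i) * u r) * δ r i
    termwise r = by-cases (r Fin.≟ i)
      where
      by-cases : Dec (r ≡ i) → lookup (w [ i ]≔ a) r * u r ≡ lookup w r * u r + ((a - lookup w i) * u r) * δ r i
      by-cases (yes refl) = begin
        lookup (w [ r ]≔ a) r * u r                             ≡⟨ cong (_* u r) (lookup∘update r w a) ⟩
        a * u r                                                 ≡⟨ solve 3 (λ a wᵣ uᵣ → a :* uᵣ := wᵣ :* uᵣ :+ (a :- wᵣ) :* uᵣ) refl a (lookup w r) (u r) ⟩
        lookup w r * u r + (a - lookup w r) * u r               ≡⟨ cong (lookup w r * u r +_) (sym (trans (cong ((a - lookup w r) * u r *_) (δ-refl r)) (*-identityʳ _))) ⟩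
        lookup w r * u r + ((a - lookup w r) * u r) * δ r r     ∎
      by-cases (no r≢i) = begin
        lookup (w [ i ]≔ a) r * u r                             ≡⟨ cong (_* u r) (lookup∘update′ r≢i w a) ⟩
        lookup w r * u r                                        ≡⟨ sym (+-identityʳ _) ⟩
        lookup w r * u r + 0#                                   ≡⟨ cong (lookup w r * u r +_) (sym (trans (cong ((a - lookup w i) * u r *_) (δ-≢ r≢i)) (zeroʳ _))) ⟩
        lookup w r * u r + ((a - lookup w i) * u r) * δ r i     ∎

  transvection : Idx → Col → V → V
  transvection i u w = w [ i ]≔ rowCol (lookup w) u

  transvection⁻¹ : (i : Idx) (u : Col) → u i ≢ 0# → V → V
  transvection⁻¹ i u uᵢ≢0 w = w [ i ]≔ (lookup w i + (lookup w i - rowCol (lookup w) u) * inv (u i) uᵢ≢0)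

  module _ (i : Idx) (u : Col) (uᵢ≢0 : u i ≢ 0#) where

    private
      v = inv (u i) uᵢ≢0

    transvection⁻¹-inverseˡ : ∀ w → transvection⁻¹ i u uᵢ≢0 (transvection i u w) ≡ w
    transvection⁻¹-inverseˡ w = ≗⇒≡ coordinate
      where
      s = rowCol (lookup w) u
      wᵢ = lookup w i
      coordinate : ∀ r → lookup (transvection⁻¹ i u uᵢ≢0 (transvection i u w)) r ≡ lookup w r
      coordinate r with r Fin.≟ i
      ... | no r≢i = trans (lookup∘update′ r≢i (transvection i u w) _) (lookup∘update′ r≢i w s)
      ... | yes refl = begin
        lookup (transvection⁻¹ i u uᵢ≢0 (transvection i u w)) i  ≡⟨ lookup∘update i (w [ i ]≔ s) _ ⟩
        lookup (w [ i ]≔ s) i + (lookup (w [ i ]≔ s) i - rowCol (lookup (w [ i ]≔ s)) u) * v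
          ≡⟨ cong₂ (λ a b → a + (a - b) * v) (lookup∘update i w s) (rowCol-update w i s u) ⟩
        s + (s - (s + (s - wᵢ) * u i)) * v  ≡⟨ solve 4 (λ s wᵢ uᵢ v → s :+ (s :- (s :+ (s :- wᵢ) :* uᵢ)) :* v := s :- (s :- wᵢ) :* (uᵢ :* v)) refl s wᵢ (u i) v ⟩
        s - (s - wᵢ) * (u i * v)            ≡⟨ cong (λ t → s - (s - wᵢ) * t) (*-inverseʳ (u i) uᵢ≢0) ⟩
        s - (s - wᵢ) * 1#                   ≡⟨ cong (λ t → s - t) (*-identityʳ (s - wᵢ)) ⟩
        s - (s - wᵢ)                        ≡⟨ solve 2 (λ s wᵢ → s :- (s :- wᵢ) := wᵢ) refl s wᵢ ⟩
        wᵢ                                  ∎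

    transvection⁻¹-inverseʳ : ∀ w → transvection i u (transvection⁻¹ i u uᵢ≢0 w) ≡ w
    transvection⁻¹-inverseʳ w = ≗⇒≡ coordinate
      where
      s = rowCol (lookup w) u
      wᵢ = lookup w i
      w′ = transvection⁻¹ i u uᵢ≢0 w
      coordinate : ∀ r → lookup (transvection i u w′) r ≡ lookup w r
      coordinate r with r Fin.≟ i
      ... | no r≢i = trans (lookup∘update′ r≢i w′ _) (lookup∘update′ r≢i w _)
      ... | yes refl = begin
        lookup (transvection i u w′) i                  ≡⟨ lookup∘update i w′ _ ⟩
        rowCol (lookup w′) u                            ≡⟨ rowCol-update w i _ u ⟩
        s + ((wᵢ + (wᵢ - s) * v) - wᵢ) * u i            ≡⟨ solve 4 (λ s wᵢ uᵢ v → s :+ ((wᵢ :+ (wᵢ :- s) :* v) :- wᵢ) :* uᵢ := s :+ (wᵢ :- s) :* (uᵢ :* v)) refl s wᵢ (u i) v ⟩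
        s + (wᵢ - s) * (u i * v)                        ≡⟨ cong (λ t → s + (wᵢ - s) * t) (*-inverseʳ (u i) uᵢ≢0) ⟩
        s + (wᵢ - s) * 1#                               ≡⟨ cong (s +_) (*-identityʳ (wᵢ - s)) ⟩
        s + (wᵢ - s)                                    ≡⟨ solve 2 (λ s wᵢ → s :+ (wᵢ :- s) := wᵢ) refl s wᵢ ⟩
        wᵢ                                              ∎

    count-transvection : ∀ {P Q : V → Set} (P? : Decidable P) (Q? : Decidable Q) →
      (∀ w → P w ⇔ Q (transvection i u w)) → count P? allV ≡ count Q? allV
    count-transvection P? Q? = count-vectors-bijection P? Q? (transvection i u) (transvection⁻¹ i u uᵢ≢0)
      transvection⁻¹-inverseˡ transvection⁻¹-inverseʳ

  transpose-ˡ : ∀ (a b : Idx) → Perm.transpose a b a ≡ b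
  transpose-ˡ a b rewrite dec-true (a Fin.≟ a) refl = refl

  transpose-fix : ∀ {a b k : Idx} → k ≢ a → k ≢ b → Perm.transpose a b k ≡ k
  transpose-fix {a} {b} {k} k≢a k≢b rewrite dec-false (k Fin.≟ a) k≢a | dec-false (k Fin.≟ b) k≢b = refl

  transpose-injective : ∀ (a b : Idx) {k l} → Perm.transpose a b k ≡ Perm.transpose a b l → k ≡ l
  transpose-injective a b {k} {l} eq =
    trans (sym (Perm.transpose-inverse b a)) (trans (cong (Perm.transpose b a) eq) (Perm.transpose-inverse b a))

  transposeCoords : Idx → Idx → V → V
  transposeCoords a b v = tabulate (λ r → lookup v (Perm.transpose a b r))

  transposeCoords-inverse : ∀ a b v → transposeCoords a b (transposeCoords b a v) ≡ v
  transposeCoords-inverse a b v = ≗⇒≡ (λ r →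
    trans (lookup∘tabulate (λ r → lookup (transposeCoords b a v) (Perm.transpose a b r)) r)
          (trans (lookup∘tabulate (λ r → lookup v (Perm.transpose b a r)) (Perm.transpose a b r))
                 (cong (lookup v) (Perm.transpose-inverse b a))))

  ZeroNonzero : Idx → Idx → V → Set
  ZeroNonzero i j w = lookup w i ≡ 0# × lookup w j ≢ 0#

  zeroNonzero? : ∀ i j → Decidable (ZeroNonzero i j)
  zeroNonzero? i j w = (lookup w i ≟ 0#) ×-dec ¬? (lookup w j ≟ 0#)

  #zeroNonzero : ℕ
  #zeroNonzero = count (zeroNonzero? zero (suc zero)) allV

  count-zeroNonzero-transpose : ∀ a b i j →
    count (zeroNonzero? i j) allV ≡ count (zeroNonzero? (Perm.transpose b a i) (Perm.transpose b a j)) allV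
  count-zeroNonzero-transpose a b i j =
    count-vectors-bijection (zeroNonzero? i j) (zeroNonzero? _ _) (transposeCoords a b) (transposeCoords b a)
      (transposeCoords-inverse b a) (transposeCoords-inverse a b) moved
    where
    moved-lookup : ∀ w k → lookup (transposeCoords a b w) (Perm.transpose b a k) ≡ lookup w k
    moved-lookup w k = trans (lookup∘tabulate (λ r → lookup w (Perm.transpose a b r)) (Perm.transpose b a k))
                             (cong (lookup w) (Perm.transpose-inverse a b))
    moved : ∀ w → ZeroNonzero i j w ⇔ ZeroNonzero (Perm.transpose b a i) (Perm.transpose b a j) (transposeCoords a b w)
    moved w = mk⇔ (λ (wᵢ≡0 , wⱼ≢0) → trans (moved-lookup w i) wᵢ≡0 , λ ≡0 → wⱼ≢0 (trans (sym (moved-lookup w j)) ≡0))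
                  (λ (wᵢ≡0 , wⱼ≢0) → trans (sym (moved-lookup w i)) wᵢ≡0 , λ ≡0 → wⱼ≢0 (trans (moved-lookup w j) ≡0))

  count-zeroNonzero : ∀ {i j} → i ≢ j → count (zeroNonzero? i j) allV ≡ #zeroNonzero
  count-zeroNonzero {i} {j} i≢j = begin
    count (zeroNonzero? i j) allV
      ≡⟨ count-zeroNonzero-transpose zero i i j ⟩
    count (zeroNonzero? (Perm.transpose i zero i) j₁) allV
      ≡⟨ cong (λ k → count (zeroNonzero? k j₁) allV) (transpose-ˡ i zero) ⟩
    count (zeroNonzero? zero j₁) allV
      ≡⟨ count-zeroNonzero-transpose (suc zero) j₁ zero j₁ ⟩
    count (zeroNonzero? (Perm.transpose j₁ (suc zero) zero) (Perm.transpose j₁ (suc zero) j₁)) allV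
      ≡⟨ cong₂ (λ k l → count (zeroNonzero? k l) allV) (transpose-fix (λ 0≡j₁ → j₁≢0 (sym 0≡j₁)) (λ ())) (transpose-ˡ j₁ (suc zero)) ⟩
    #zeroNonzero ∎
    where
    j₁ = Perm.transpose i zero j
    j₁≢0 : j₁ ≢ zero
    j₁≢0 j₁≡0 = i≢j (sym (transpose-injective i zero (trans j₁≡0 (sym (transpose-ˡ i zero)))))

  ZeroSeparates : Idx → Col → V → Set
  ZeroSeparates i y w = lookup w i ≡ 0# × rowCol (lookup w) y ≢ 0#

  zeroSeparates? : ∀ i y → Decidable (ZeroSeparates i y)
  zeroSeparates? i y w = (lookup w i ≟ 0#) ×-dec ¬? (rowCol (lookup w) y ≟ 0#)

  count-separates-shift : ∀ x y c → count (separates? x y) allV ≡ count (separates? x (λ r → y r + c * x r)) allV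
  count-separates-shift x y c = count-cong (separates? x y) (separates? x _) allV
    (λ w _ (wx≡0 , wy≢0) → wx≡0 , λ ≡0 → wy≢0 (trans (sym (shifted w wx≡0)) ≡0))
    (λ w _ (wx≡0 , wy′≢0) → wx≡0 , λ ≡0 → wy′≢0 (trans (shifted w wx≡0) ≡0))
    where
    shifted : ∀ w → rowCol (lookup w) x ≡ 0# → rowCol (lookup w) (λ r → y r + c * x r) ≡ rowCol (lookup w) y
    shifted w wx≡0 = begin
      rowCol (lookup w) (λ r → y r + c * x r)         ≡⟨ rowCol-linearʳ (lookup w) y x c ⟩
      rowCol (lookup w) y + c * rowCol (lookup w) x   ≡⟨ cong (λ t → rowCol (lookup w) y + c * t) wx≡0 ⟩
      rowCol (lookup w) y + c * 0#                    ≡⟨ cong (rowCol (lookup w) y +_) (zeroʳ c) ⟩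
      rowCol (lookup w) y + 0#                        ≡⟨ +-identityʳ _ ⟩
      rowCol (lookup w) y                             ∎

  rowCol-transvection : ∀ i (u z : Col) w → z i ≡ 0# → rowCol (lookup (transvection i u w)) z ≡ rowCol (lookup w) z
  rowCol-transvection i u z w zᵢ≡0 = begin
    rowCol (lookup (transvection i u w)) z                               ≡⟨ rowCol-update w i _ z ⟩
    rowCol (lookup w) z + (rowCol (lookup w) u - lookup w i) * z i      ≡⟨ cong (λ t → rowCol (lookup w) z + (rowCol (lookup w) u - lookup w i) * t) zᵢ≡0 ⟩
    rowCol (lookup w) z + (rowCol (lookup w) u - lookup w i) * 0#       ≡⟨ cong (rowCol (lookup w) z +_) (zeroʳ _) ⟩
    rowCol (lookup w) z + 0#                                             ≡⟨ +-identityʳ _ ⟩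
    rowCol (lookup w) z                                                  ∎

  count-separates⇒zeroSeparates : ∀ {i} {x z : Col} → x i ≢ 0# → z i ≡ 0# →
    count (separates? x z) allV ≡ count (zeroSeparates? i z) allV
  count-separates⇒zeroSeparates {i} {x} {z} xᵢ≢0 zᵢ≡0 =
    count-transvection i x xᵢ≢0 (separates? x z) (zeroSeparates? i z) (λ w → mk⇔
      (λ (wx≡0 , wz≢0) → trans (lookup∘update i w _) wx≡0 , λ ≡0 → wz≢0 (trans (sym (rowCol-transvection i x z w zᵢ≡0)) ≡0))
      (λ (w′ᵢ≡0 , w′z≢0) → trans (sym (lookup∘update i w _)) w′ᵢ≡0 , λ ≡0 → w′z≢0 (trans (rowCol-transvection i x z w zᵢ≡0) ≡0)))

  count-zeroSeparates⇒zeroNonzero : ∀ {i j} {z : Col} → z j ≢ 0# → i ≢ j →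
    count (zeroSeparates? i z) allV ≡ count (zeroNonzero? i j) allV
  count-zeroSeparates⇒zeroNonzero {i} {j} {z} zⱼ≢0 i≢j =
    count-transvection j z zⱼ≢0 (zeroSeparates? i z) (zeroNonzero? i j) (λ w → mk⇔
      (λ (wᵢ≡0 , wz≢0) → trans (lookup∘update′ i≢j w _) wᵢ≡0 , λ ≡0 → wz≢0 (trans (sym (lookup∘update j w _)) ≡0))
      (λ (w′ᵢ≡0 , w′ⱼ≢0) → trans (sym (lookup∘update′ i≢j w _)) w′ᵢ≡0 , λ ≡0 → w′ⱼ≢0 (trans (lookup∘update j w _) ≡0)))

  eigenvector? : (M : Mat) → Decidable (λ (v : V) → Eigenvector M (lookup v))
  eigenvector? M v = ∃? (λ a → all? (λ i → (M *ᵥ lookup v) i ≟ (a * lookup v i)))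

  fibre-eigenvector : ∀ M (v : V) → Eigenvector M (lookup v) → count (separates? (lookup v) (M *ᵥ lookup v)) allV ≡ 0
  fibre-eigenvector M v (a , Mv≡av) = count-none _ allV (λ w _ (wv≡0 , wMv≢0) → wMv≢0 (begin
    rowCol (lookup w) (M *ᵥ lookup v)          ≡⟨ rowCol-cong {lookup w} (λ _ → refl) Mv≡av ⟩
    rowCol (lookup w) (λ i → a * lookup v i)   ≡⟨ rowCol-scaleʳ (lookup w) (lookup v) a ⟩
    a * rowCol (lookup w) (lookup v)           ≡⟨ cong (a *_) wv≡0 ⟩
    a * 0#                                     ≡⟨ zeroʳ a ⟩
    0#                                         ∎))

  module _ (M : Mat) (x : Col) {i : Idx} (xᵢ≢0 : x i ≢ 0#) where

    private
      c = (M *ᵥ x) i * inv (x i) xᵢ≢0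

    residual : Col
    residual r = (M *ᵥ x) r + (- c) * x r

    residual-pivot : residual i ≡ 0#
    residual-pivot = begin
      (M *ᵥ x) i + (- ((M *ᵥ x) i * x⁻¹)) * x i ≡⟨ solve 3 (λ y x⁻¹ xᵢ → y :+ (:- (y :* x⁻¹)) :* xᵢ := y :- y :* (x⁻¹ :* xᵢ)) refl ((M *ᵥ x) i) x⁻¹ (x i) ⟩
      (M *ᵥ x) i - (M *ᵥ x) i * (x⁻¹ * x i)     ≡⟨ cong (λ t → (M *ᵥ x) i - (M *ᵥ x) i * t) (*-inverseˡ (x i) xᵢ≢0) ⟩
      (M *ᵥ x) i - (M *ᵥ x) i * 1#              ≡⟨ cong (λ t → (M *ᵥ x) i - t) (*-identityʳ _) ⟩
      (M *ᵥ x) i - (M *ᵥ x) i                   ≡⟨ -‿inverseʳ _ ⟩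
      0#                                        ∎
      where x⁻¹ = inv (x i) xᵢ≢0

    residual-zero⇒eigenvector : (∀ r → residual r ≡ 0#) → Eigenvector M x
    residual-zero⇒eigenvector residual≡0 = c , λ r → begin
      (M *ᵥ x) r                        ≡⟨ solve 3 (λ y c x → y := (y :+ (:- c) :* x) :+ c :* x) refl ((M *ᵥ x) r) c (x r) ⟩
      residual r + c * x r              ≡⟨ cong (_+ c * x r) (residual≡0 r) ⟩
      0# + c * x r                      ≡⟨ +-identityˡ _ ⟩
      c * x r                           ∎

  fibre-nonEigenvector : ∀ M (v : V) → ¬ Eigenvector M (lookup v) →
    count (separates? (lookup v) (M *ᵥ lookup v)) allV ≡ #zeroNonzero
  fibre-nonEigenvector M v ¬eigen with nonzero? (lookup v)
  ... | no v≡0 = ⊥-elim (¬eigen (0# , λ i → trans (*ᵥ-zero M (¬nonzero⇒zero v≡0) i) (sym (zeroˡ _))))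
  ... | yes (i , xᵢ≢0) with nonzero? (residual M (lookup v) xᵢ≢0)
  ...   | no z≡0 = ⊥-elim (¬eigen (residual-zero⇒eigenvector M (lookup v) xᵢ≢0 (¬nonzero⇒zero z≡0)))
  ...   | yes (j , zⱼ≢0) = begin
    count (separates? x (M *ᵥ x)) allV  ≡⟨ count-separates-shift x (M *ᵥ x) _ ⟩
    count (separates? x z) allV         ≡⟨ count-separates⇒zeroSeparates xᵢ≢0 zᵢ≡0 ⟩
    count (zeroSeparates? i z) allV     ≡⟨ count-zeroSeparates⇒zeroNonzero zⱼ≢0 i≢j ⟩
    count (zeroNonzero? i j) allV       ≡⟨ count-zeroNonzero i≢j ⟩
    #zeroNonzero                               ∎
    where
    x = lookup v
    z = residual M x xᵢ≢0
    zᵢ≡0 : z i ≡ 0#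
    zᵢ≡0 = residual-pivot M x xᵢ≢0
    i≢j : i ≢ j
    i≢j refl = zⱼ≢0 zᵢ≡0

  offHyperplane-count-eigen : ∀ M → count (offHyperplane? M) flags ≡ count (λ v → ¬? (eigenvector? M v)) allV ℕ.* #zeroNonzero
  offHyperplane-count-eigen M = trans (count-cartesianProductWith (offHyperplane? M) _,_ allV allV)
    (sum-indicator (λ v → ¬? (eigenvector? M v)) #zeroNonzero _ allV
      (λ v _ ¬eigen → fibre-nonEigenvector M v ¬eigen)
      (λ v _ ¬¬eigen → fibre-eigenvector M v (decidable-stable (eigenvector? M v) ¬¬eigen)))

  #zeroNonzero-positive : 0 ℕ.< #zeroNonzero
  #zeroNonzero-positive = count-some (zeroNonzero? zero (suc zero)) e₁ (∈-vectors e₁) (refl , 1≢0)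
    where
    e₁ : V
    e₁ = 0# ∷ 1# ∷ replicate _ 0#

module EigenvectorCount (F : FiniteField) (m : ℕ) where
  open import Data.Nat as ℕ using (ℕ; zero; suc; _^_)

  import Data.Nat.Properties as ℕ
  open import Data.Fin as Fin using (Fin; zero; suc)
  open import Data.Fin.Properties using (all?; ¬∀⟶∃¬)
  open import Data.Vec using (Vec; _∷_; lookup; tabulate; replicate)
  open import Data.Vec.Properties using (lookup∘tabulate; lookup-replicate; ≡-dec)
  open import Data.List using (List; map; cartesianProduct)
  open import Data.Nat.ListAction using (sum)
  open import Data.List.Membership.Propositional using (_∈_)
  open import Data.List.Relation.Unary.Any using (Any; here; there; any?; satisfied)
  import Data.List.Relation.Unary.Any as Any
  import Data.List.Relation.Unary.Unique.Propositional.Properties as Unique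
  open import Data.Product using (Σ; _×_; _,_; proj₁; proj₂)
  open import Data.Sum as Sum using (_⊎_; inj₁; inj₂)
  open import Data.Unit using (⊤; tt)
  open import Data.Empty using (⊥-elim)
  open import Function.Bundles using (_⇔_; mk⇔; Equivalence)
  open import Relation.Nullary using (¬_; Dec; yes; no)
  open import Relation.Nullary.Decidable using (_×-dec_; _⊎-dec_; ¬?; decidable-stable)
  open import Relation.Unary using (Decidable)
  open import Relation.Binary.PropositionalEquality using (_≡_; _≢_; _≗_; refl; sym; trans; cong; cong₂; subst; subst₂; module ≡-Reasoning)
  open FieldProperties F
  open import Function using (_∘_)
  open Counting
  open VectorEnumeration F
  open MatrixDefs F (suc m)
  open LinearAlgebra F (suc m)
  open Flags F (suc m)
  open NonEigenvectorFibres F m using (eigenvector?)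

  addScaled : V → Carrier → V → V
  addScaled x t y = tabulate (λ r → lookup x r + t * lookup y r)

  lookup-addScaled : ∀ x t y r → lookup (addScaled x t y) r ≡ lookup x r + t * lookup y r
  lookup-addScaled x t y r = lookup∘tabulate (λ r → lookup x r + t * lookup y r) r

  zeroV : V
  zeroV = tabulate (λ _ → 0#)

  lookup-zeroV : ∀ r → lookup zeroV r ≡ 0#
  lookup-zeroV = lookup∘tabulate (λ _ → 0#)

  IsSubspace : (V → Set) → Set
  IsSubspace S = S zeroV × (∀ x y t → S x → S y → S (addScaled x t y))

  #V : count (λ (_ : V) → yes tt) allV ≡ q ^ suc (suc m)
  #V = trans (count-all _ allV (λ _ _ → tt)) (length-vectors _)

  subspace-extension-count : ∀ {S T : V → Set} (S? : Decidable S) (T? : Decidable T) → IsSubspace S →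
    (u : V) → ¬ S u → (∀ s t → S s → T (addScaled s t u)) → count S? allV ℕ.* q ℕ.≤ count T? allV
  subspace-extension-count {S} S? T? (S0 , S-closed) u u∉S s+tu∈T =
    subst (ℕ._≤ count T? allV) #S×F
      (count-≤-injection (λ p → S? (proj₁ p) ×-dec yes tt) T? (cartesianProduct allV elements)
         (Unique.cartesianProduct⁺ (vectors-unique _) unique) allV ∈-vectors
         (λ (s , t) → addScaled s t u) (λ (s , t) (s∈S , _) → s+tu∈T s t s∈S) injective)
    where
    open ≡-Reasoning
    #S×F : count (λ p → S? (proj₁ p) ×-dec yes tt) (cartesianProduct allV elements) ≡ count S? allV ℕ.* q
    #S×F = trans (count-cartesianProduct S? (λ _ → yes tt) allV elements) (cong (count S? allV ℕ.*_) (count-all _ elements (λ _ _ → tt)))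
    injective : ∀ p p′ → S (proj₁ p) × ⊤ → S (proj₁ p′) × ⊤ → addScaled (proj₁ p) (proj₂ p) u ≡ addScaled (proj₁ p′) (proj₂ p′) u → p ≡ p′
    injective (s , t) (s′ , t′) (s∈S , _) (s′∈S , _) eq = by-cases (t ≟ t′)
      where
      coordinate : ∀ r → lookup s r + t * lookup u r ≡ lookup s′ r + t′ * lookup u r
      coordinate r = trans (sym (lookup-addScaled s t u r)) (trans (cong (λ v → lookup v r) eq) (lookup-addScaled s′ t′ u r))
      by-cases : Dec (t ≡ t′) → (s , t) ≡ (s′ , t′)
      by-cases (yes refl) = cong (_, t) (≗⇒≡ (λ r → +-cancelʳ (t * lookup u r) _ _ (coordinate r)))
      by-cases (no t≢t′) = ⊥-elim (u∉S (subst S (≗⇒≡ u-recovered) (S-closed zeroV _ (inv d d≢0) S0 (S-closed s′ s (- 1#) s′∈S s∈S))))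
        where
        d = t - t′
        d≢0 : d ≢ 0#
        d≢0 d≡0 = t≢t′ (x-y≡0⇒x≡y d≡0)
        u-recovered : ∀ r → lookup (addScaled zeroV (inv d d≢0) (addScaled s′ (- 1#) s)) r ≡ lookup u r
        u-recovered r = begin
          lookup (addScaled zeroV (inv d d≢0) (addScaled s′ (- 1#) s)) r
            ≡⟨ trans (lookup-addScaled zeroV (inv d d≢0) (addScaled s′ (- 1#) s) r) (cong₂ (λ a b → a + inv d d≢0 * b) (lookup-zeroV r) (lookup-addScaled s′ (- 1#) s r)) ⟩
          0# + inv d d≢0 * (lookup s′ r + - 1# * lookup s r)   ≡⟨ +-identityˡ _ ⟩
          inv d d≢0 * (lookup s′ r + - 1# * lookup s r)        ≡⟨ cong (λ a → inv d d≢0 * (lookup s′ r + a)) (-1*x≈-x (lookup s r)) ⟩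
          inv d d≢0 * (lookup s′ r - lookup s r)               ≡⟨ cong (inv d d≢0 *_) (sym difference) ⟩
          inv d d≢0 * (d * lookup u r)                         ≡⟨ inv-*-cancelˡ d d≢0 (lookup u r) ⟩
          lookup u r                                           ∎
          where
          difference : d * lookup u r ≡ lookup s′ r - lookup s r
          difference = begin
            (t - t′) * lookup u r                                          ≡⟨ solve 4 (λ s t t′ u → (t :- t′) :* u := ((s :+ t :* u) :- s) :- t′ :* u) refl (lookup s r) t t′ (lookup u r) ⟩
            ((lookup s r + t * lookup u r) - lookup s r) - t′ * lookup u r   ≡⟨ cong (λ a → (a - lookup s r) - t′ * lookup u r) (coordinate r) ⟩
            ((lookup s′ r + t′ * lookup u r) - lookup s r) - t′ * lookup u r ≡⟨ solve 4 (λ s s′ t′ u → ((s′ :+ t′ :* u) :- s) :- t′ :* u := s′ :- s) refl (lookup s r) (lookup s′ r) t′ (lookup u r) ⟩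
            lookup s′ r - lookup s r                                       ∎

  eigenspace? : ∀ M a → Decidable (λ (v : V) → Eigenspace M a (lookup v))
  eigenspace? M a v = all? (λ i → (M *ᵥ lookup v) i ≟ (a * lookup v i))

  eigenspace-isSubspace : ∀ M a → IsSubspace (λ v → Eigenspace M a (lookup v))
  eigenspace-isSubspace M a = zero∈ , closed
    where
    open ≡-Reasoning
    zero∈ : Eigenspace M a (lookup zeroV)
    zero∈ i = trans (*ᵥ-zero M lookup-zeroV i) (sym (trans (cong (a *_) (lookup-zeroV i)) (zeroʳ a)))
    closed : ∀ x y t → Eigenspace M a (lookup x) → Eigenspace M a (lookup y) → Eigenspace M a (lookup (addScaled x t y))
    closed x y t Mx≡ax My≡ay i = begin
      (M *ᵥ lookup (addScaled x t y)) i                  ≡⟨ *ᵥ-cong M (lookup-addScaled x t y) i ⟩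
      (M *ᵥ (λ r → lookup x r + t * lookup y r)) i       ≡⟨ *ᵥ-linear M (lookup x) (lookup y) t i ⟩
      (M *ᵥ lookup x) i + t * (M *ᵥ lookup y) i          ≡⟨ cong₂ (λ b c → b + t * c) (Mx≡ax i) (My≡ay i) ⟩
      a * lookup x i + t * (a * lookup y i)              ≡⟨ solve 4 (λ a x t y → a :* x :+ t :* (a :* y) := a :* (x :+ t :* y)) refl a (lookup x i) t (lookup y i) ⟩
      a * (lookup x i + t * lookup y i)                  ≡⟨ cong (a *_) (sym (lookup-addScaled x t y i)) ⟩
      a * lookup (addScaled x t y) i                     ∎

  #eigenspace : Mat → Carrier → ℕ
  #eigenspace M a = count (eigenspace? M a) allV

  #eigenvectors : Mat → ℕ
  #eigenvectors M = count (eigenvector? M) allV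

  proper-subspace-count : ∀ {S : V → Set} (S? : Decidable S) → IsSubspace S → (u : V) → ¬ S u →
    count S? allV ℕ.≤ q ^ suc m
  proper-subspace-count S? S-sub u u∉S = ℕ.*-cancelʳ-≤ _ _ q {{q-nonZero}}
    (subst (count S? allV ℕ.* q ℕ.≤_) (trans #V (ℕ.*-comm q (q ^ suc m)))
      (subspace-extension-count S? (λ _ → yes tt) S-sub u u∉S (λ _ _ _ → tt)))

  module LargeEigenspace (M : Mat) (a : Carrier) (w : V) (w∉Eₐ : ¬ Eigenspace M a (lookup w)) where

    open ≡-Reasoning

    InSpan : V → Set
    InSpan x = Σ Carrier λ t → Eigenspace M a (lookup (addScaled x (- t) w))

    inSpan? : Decidable InSpan
    inSpan? x = ∃? (λ t → eigenspace? M a (addScaled x (- t) w))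

    inSpan-isSubspace : IsSubspace InSpan
    inSpan-isSubspace = (0# , subst (Eigenspace M a ∘ lookup) (≗⇒≡ {v = zeroV} {w = addScaled zeroV (- 0#) w} zero≗) (proj₁ (eigenspace-isSubspace M a))) , closed
      where
      zero≗ : ∀ r → lookup zeroV r ≡ lookup (addScaled zeroV (- 0#) w) r
      zero≗ r = sym (begin
        lookup (addScaled zeroV (- 0#) w) r  ≡⟨ lookup-addScaled zeroV (- 0#) w r ⟩
        lookup zeroV r + - 0# * lookup w r   ≡⟨ cong (λ b → lookup zeroV r + b * lookup w r) -0#≈0# ⟩
        lookup zeroV r + 0# * lookup w r     ≡⟨ cong (lookup zeroV r +_) (zeroˡ _) ⟩
        lookup zeroV r + 0#                  ≡⟨ +-identityʳ _ ⟩
        lookup zeroV r                       ∎)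
      closed : ∀ x y c → InSpan x → InSpan y → InSpan (addScaled x c y)
      closed x y c (t , x-tw∈Eₐ) (s , y-sw∈Eₐ) = t + c * s ,
        subst (Eigenspace M a ∘ lookup) (≗⇒≡ {v = addScaled (addScaled x (- t) w) c (addScaled y (- s) w)} {w = addScaled (addScaled x c y) (- (t + c * s)) w} regroup) (proj₂ (eigenspace-isSubspace M a) (addScaled x (- t) w) (addScaled y (- s) w) c x-tw∈Eₐ y-sw∈Eₐ)
        where
        regroup : ∀ r → lookup (addScaled (addScaled x (- t) w) c (addScaled y (- s) w)) r
                      ≡ lookup (addScaled (addScaled x c y) (- (t + c * s)) w) r
        regroup r = begin
          lookup (addScaled (addScaled x (- t) w) c (addScaled y (- s) w)) r
            ≡⟨ lookup-addScaled (addScaled x (- t) w) c (addScaled y (- s) w) r ⟩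
          lookup (addScaled x (- t) w) r + c * lookup (addScaled y (- s) w) r
            ≡⟨ cong₂ (λ b d → b + c * d) (lookup-addScaled x (- t) w r) (lookup-addScaled y (- s) w r) ⟩
          (lookup x r + - t * lookup w r) + c * (lookup y r + - s * lookup w r)
            ≡⟨ solve 6 (λ x t w c y s → (x :+ (:- t) :* w) :+ c :* (y :+ (:- s) :* w) := (x :+ c :* y) :+ (:- (t :+ c :* s)) :* w)
                       refl (lookup x r) t (lookup w r) c (lookup y r) s ⟩
          (lookup x r + c * lookup y r) + - (t + c * s) * lookup w r
            ≡⟨ cong (_+ - (t + c * s) * lookup w r) (sym (lookup-addScaled x c y r)) ⟩
          lookup (addScaled x c y) r + - (t + c * s) * lookup w r
            ≡⟨ sym (lookup-addScaled (addScaled x c y) (- (t + c * s)) w r) ⟩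
          lookup (addScaled (addScaled x c y) (- (t + c * s)) w) r ∎

    eigenspace-extension : #eigenspace M a ℕ.* q ℕ.≤ count inSpan? allV
    eigenspace-extension = subspace-extension-count (eigenspace? M a) inSpan? (eigenspace-isSubspace M a) w w∉Eₐ
      (λ s t s∈Eₐ → t , subst (Eigenspace M a ∘ lookup) (≗⇒≡ {v = s} {w = addScaled (addScaled s t w) (- t) w} (back s t)) s∈Eₐ)
      where
      back : ∀ s t r → lookup s r ≡ lookup (addScaled (addScaled s t w) (- t) w) r
      back s t r = sym (begin
        lookup (addScaled (addScaled s t w) (- t) w) r     ≡⟨ lookup-addScaled (addScaled s t w) (- t) w r ⟩
        lookup (addScaled s t w) r + - t * lookup w r      ≡⟨ cong (_+ - t * lookup w r) (lookup-addScaled s t w r) ⟩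
        (lookup s r + t * lookup w r) + - t * lookup w r   ≡⟨ solve 3 (λ s t w → (s :+ t :* w) :+ (:- t) :* w := s) refl (lookup s r) t (lookup w r) ⟩
        lookup s r                                         ∎)

    spanning : q ^ m ℕ.< #eigenspace M a → ∀ u → InSpan u
    spanning large u = decidable-stable (inSpan? u) λ u∉span →
      ℕ.<⇒≱ large (ℕ.*-cancelʳ-≤ _ _ q {{q-nonZero}}
        (ℕ.≤-trans eigenspace-extension (subst (count inSpan? allV ℕ.≤_) (ℕ.*-comm q (q ^ m)) (proper-subspace-count inSpan? inSpan-isSubspace u u∉span))))

    module _ (large : q ^ m ℕ.< #eigenspace M a) where

      basis : Idx → V
      basis j = tabulate (λ r → δ r j)

      η : Row
      η j = proj₁ (spanning large (basis j))

      y : Col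
      y i = (M *ᵥ lookup w) i + - a * lookup w i

      decomposition : ∀ i j → M i j ≡ y i * η j + a * δ i j
      decomposition i j = isolate (M i j) ((M *ᵥ lookup w) i) (δ i j) (lookup w i) (η j) (begin
        M i j + - η j * (M *ᵥ lookup w) i                 ≡⟨ cong (_+ - η j * (M *ᵥ lookup w) i) (sym (sumIdx-δʳ j (M i))) ⟩
        (M *ᵥ (λ r → δ r j)) i + - η j * (M *ᵥ lookup w) i ≡⟨ sym (*ᵥ-linear M (λ r → δ r j) (lookup w) (- η j) i) ⟩
        (M *ᵥ (λ r → δ r j + - η j * lookup w r)) i        ≡⟨ *ᵥ-cong M (λ r → sym (trans (lookup-addScaled (basis j) (- η j) w r) (cong (_+ - η j * lookup w r) (lookup∘tabulate (λ r → δ r j) r)))) i ⟩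
        (M *ᵥ lookup (addScaled (basis j) (- η j) w)) i   ≡⟨ proj₂ (spanning large (basis j)) i ⟩
        a * lookup (addScaled (basis j) (- η j) w) i      ≡⟨ cong (a *_) (trans (lookup-addScaled (basis j) (- η j) w i) (cong (_+ - η j * lookup w i) (lookup∘tabulate (λ r → δ r j) i))) ⟩
        a * (δ i j + - η j * lookup w i)                  ∎)
        where
        isolate : ∀ Mᵢⱼ Mwᵢ δᵢⱼ wᵢ ηⱼ → Mᵢⱼ + - ηⱼ * Mwᵢ ≡ a * (δᵢⱼ + - ηⱼ * wᵢ) → Mᵢⱼ ≡ (Mwᵢ + - a * wᵢ) * ηⱼ + a * δᵢⱼ
        isolate Mᵢⱼ Mwᵢ δᵢⱼ wᵢ ηⱼ eq = begin
          Mᵢⱼ                                     ≡⟨ solve 3 (λ P B t → P := (P :+ (:- t) :* B) :+ t :* B) refl Mᵢⱼ Mwᵢ ηⱼ ⟩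
          (Mᵢⱼ + - ηⱼ * Mwᵢ) + ηⱼ * Mwᵢ           ≡⟨ cong (_+ ηⱼ * Mwᵢ) eq ⟩
          a * (δᵢⱼ + - ηⱼ * wᵢ) + ηⱼ * Mwᵢ        ≡⟨ solve 5 (λ B D W t a → a :* (D :+ (:- t) :* W) :+ t :* B := (B :+ (:- a) :* W) :* t :+ a :* D) refl Mwᵢ δᵢⱼ wᵢ ηⱼ a ⟩
          (Mwᵢ + - a * wᵢ) * ηⱼ + a * δᵢⱼ         ∎

      *ᵥ-decomposition : ∀ (x : Col) i → (M *ᵥ x) i ≡ y i * rowCol η x + a * x i
      *ᵥ-decomposition x i = begin
        sumIdx (λ j → M i j * x j)                                 ≡⟨ sumIdx-cong (λ j → trans (cong (_* x j) (decomposition i j))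
                                                                        (solve 5 (λ Y e a d x → (Y :* e :+ a :* d) :* x := Y :* (e :* x) :+ a :* (d :* x)) refl (y i) (η j) a (δ i j) (x j))) ⟩
        sumIdx (λ j → y i * (η j * x j) + a * (δ i j * x j))       ≡⟨ sumIdx-+ _ _ ⟩
        sumIdx (λ j → y i * (η j * x j)) + sumIdx (λ j → a * (δ i j * x j)) ≡⟨ cong₂ _+_ (sumIdx-*ˡ (y i) _) (trans (sumIdx-*ˡ a _) (cong (a *_) (sumIdx-δˡ i x))) ⟩
        y i * rowCol η x + a * x i                                 ∎

      y-nonzero : NonzeroVec y
      y-nonzero = let (i , Mwᵢ≢awᵢ) = ¬∀⟶∃¬ _ _ (λ i → (M *ᵥ lookup w) i ≟ (a * lookup w i)) w∉Eₐ in
        i , λ yᵢ≡0 → Mwᵢ≢awᵢ (x-y≡0⇒x≡y (trans (cong ((M *ᵥ lookup w) i +_) (-‿distribˡ-* a (lookup w i))) yᵢ≡0))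

      η-nonzero : NonzeroVec η
      η-nonzero = from-pivot y-nonzero
        where
        from-pivot : NonzeroVec y → NonzeroVec η
        from-pivot (i , yᵢ≢0) = rowCol≢0⇒nonzeroˡ (lookup w) λ ηw≡0 → yᵢ≢0 (begin
            y i                                                             ≡⟨ cong (_+ - a * lookup w i) (*ᵥ-decomposition (lookup w) i) ⟩
            (y i * rowCol η (lookup w) + a * lookup w i) + - a * lookup w i ≡⟨ solve 4 (λ Y s a W → (Y :* s :+ a :* W) :+ (:- a) :* W := Y :* s) refl (y i) (rowCol η (lookup w)) a (lookup w i) ⟩
            y i * rowCol η (lookup w)                                       ≡⟨ cong (y i *_) ηw≡0 ⟩
            y i * 0#                                                        ≡⟨ zeroʳ _ ⟩
            0#                                                              ∎)

      traceless⇒eigenvector⇒eigenspace : rowCol η y ≡ 0# → ∀ {x} → Eigenvector M x → Eigenspace M a x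
      traceless⇒eigenvector⇒eigenspace ηy≡0 {x} (l , Mx≡lx) = by-cases (rowCol η x ≟ 0#)
        where
        s = rowCol η x
        by-cases : Dec (s ≡ 0#) → Eigenspace M a x
        by-cases (yes s≡0) i = begin
          (M *ᵥ x) i         ≡⟨ *ᵥ-decomposition x i ⟩
          y i * s + a * x i  ≡⟨ cong (λ t → y i * t + a * x i) s≡0 ⟩
          y i * 0# + a * x i ≡⟨ cong (_+ a * x i) (zeroʳ (y i)) ⟩
          0# + a * x i       ≡⟨ +-identityˡ _ ⟩
          a * x i            ∎
        by-cases (no s≢0) i = trans (Mx≡lx i) (cong (_* x i) (*-cancelʳ s≢0 eigenvalues))
          where
          eigenvalues : l * s ≡ a * s
          eigenvalues = begin
            l * s                                ≡⟨ sym (rowCol-scaleʳ η x l) ⟩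
            rowCol η (λ i → l * x i)             ≡⟨ rowCol-cong {η} (λ _ → refl) (λ i → trans (sym (Mx≡lx i)) (trans (*ᵥ-decomposition x i) (cong (_+ a * x i) (*-comm (y i) s)))) ⟩
            rowCol η (λ i → s * y i + a * x i)   ≡⟨ rowCol-linearʳ η (λ i → s * y i) x a ⟩
            rowCol η (λ i → s * y i) + a * s     ≡⟨ cong (_+ a * s) (rowCol-scaleʳ η y s) ⟩
            s * rowCol η y + a * s               ≡⟨ cong (λ t → s * t + a * s) ηy≡0 ⟩
            s * 0# + a * s                       ≡⟨ cong (_+ a * s) (zeroʳ s) ⟩
            0# + a * s                           ≡⟨ +-identityˡ _ ⟩
            a * s                                ∎

      rankOneShift-or-fewEigenvectors :
        (Σ Mat λ N → Rank1 N × Tr N ≢ 0# × (∀ i j → M i j ≡ N i j + a * δ i j)) ⊎ (#eigenvectors M ℕ.≤ q ^ suc m)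
      rankOneShift-or-fewEigenvectors = by-cases (rowCol η y ≟ 0#)
        where
        by-cases : Dec (rowCol η y ≡ 0#) →
          (Σ Mat λ N → Rank1 N × Tr N ≢ 0# × (∀ i j → M i j ≡ N i j + a * δ i j)) ⊎ (#eigenvectors M ℕ.≤ q ^ suc m)
        by-cases (no ηy≢0)  = inj₁ (outer y η , (y , η , y-nonzero , η-nonzero , λ _ _ → refl) ,
                                    (λ TrN≡0 → ηy≢0 (trans (sym (Tr-outer (λ _ _ → refl))) TrN≡0)) , decomposition)
        by-cases (yes ηy≡0) = inj₂ (ℕ.≤-trans (count-mono (eigenvector? M) (eigenspace? M a) allV (λ v _ → traceless⇒eigenvector⇒eigenspace ηy≡0))
                                              (proper-subspace-count (eigenspace? M a) (eigenspace-isSubspace M a) w w∉Eₐ))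

  module _ (M : Mat) where

    private
      nonzeroEigen? : ∀ a → Decidable (λ v → Eigenspace M a (lookup v) × v ≢ zeroV)
      nonzeroEigen? a v = eigenspace? M a v ×-dec ¬? (≡-dec _≟_ v zeroV)

    #eigenvectors-≤ : #eigenvectors M ℕ.≤ 1 ℕ.+ sum (map (λ a → count (nonzeroEigen? a) allV) elements)
    #eigenvectors-≤ = begin
      #eigenvectors M
        ≤⟨ count-mono (eigenvector? M) zero-or-nonzero? allV (λ v _ → split v) ⟩
      count zero-or-nonzero? allV
        ≤⟨ count-∪ (λ v → ≡-dec _≟_ v zeroV) (λ v → any? (λ a → nonzeroEigen? a v) elements) allV ⟩
      count (λ v → ≡-dec _≟_ v zeroV) allV ℕ.+ count (λ v → any? (λ a → nonzeroEigen? a v) elements) allV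
        ≤⟨ ℕ.+-mono-≤ (count-≤-1 _ allV (vectors-unique _) (λ v v′ v≡0 v′≡0 → trans v≡0 (sym v′≡0)))
                      (count-⋃ _ nonzeroEigen? elements allV (λ _ any → any)) ⟩
      1 ℕ.+ sum (map (λ a → count (nonzeroEigen? a) allV) elements) ∎
      where
      open ℕ.≤-Reasoning
      zero-or-nonzero? : Decidable (λ v → v ≡ zeroV ⊎ Any (λ a → Eigenspace M a (lookup v) × v ≢ zeroV) elements)
      zero-or-nonzero? v = ≡-dec _≟_ v zeroV ⊎-dec any? (λ a → nonzeroEigen? a v) elements
      split : ∀ v → Eigenvector M (lookup v) → v ≡ zeroV ⊎ Any (λ a → Eigenspace M a (lookup v) × v ≢ zeroV) elements
      split v (l , Mv≡lv) with ≡-dec _≟_ v zeroV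
      ... | yes v≡0 = inj₁ v≡0
      ... | no v≢0  = inj₂ (Any.map (λ { refl → Mv≡lv , v≢0 }) (complete l))

    #nonzeroEigen<#eigenspace : ∀ a → count (nonzeroEigen? a) allV ℕ.+ 1 ℕ.≤ #eigenspace M a
    #nonzeroEigen<#eigenspace a = subst (count (nonzeroEigen? a) allV ℕ.+ 1 ℕ.≤_)
      (sym (count-split (eigenspace? M a) (λ v → ¬? (≡-dec _≟_ v zeroV)) allV))
      (ℕ.+-monoʳ-≤ _ (count-some _ zeroV (∈-vectors zeroV) (proj₁ (eigenspace-isSubspace M a) , λ 0≢0 → 0≢0 refl)))

    small-eigenspaces⇒fewEigenvectors : (∀ a → #eigenspace M a ℕ.≤ q ^ m) → #eigenvectors M ℕ.+ q ℕ.≤ 1 ℕ.+ q ^ suc m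
    small-eigenspaces⇒fewEigenvectors small = begin
      #eigenvectors M ℕ.+ q                                          ≤⟨ ℕ.+-monoˡ-≤ q #eigenvectors-≤ ⟩
      1 ℕ.+ Σ₀ ℕ.+ q                                                 ≡⟨ ℕ.+-assoc 1 Σ₀ q ⟩
      1 ℕ.+ (Σ₀ ℕ.+ q)                                               ≡⟨ cong (1 ℕ.+_) (sym (trans (sum-+ _ (λ _ → 1) elements) (cong (Σ₀ ℕ.+_) (trans (sum-const 1 elements) (ℕ.*-identityʳ q))))) ⟩
      1 ℕ.+ sum (map (λ a → count (nonzeroEigen? a) allV ℕ.+ 1) elements) ≤⟨ ℕ.+-monoʳ-≤ 1 (sum-mono _ _ elements (λ a _ → ℕ.≤-trans (#nonzeroEigen<#eigenspace a) (small a))) ⟩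
      1 ℕ.+ sum (map (λ _ → q ^ m) elements)                         ≡⟨ cong (1 ℕ.+_) (trans (sum-const (q ^ m) elements) refl) ⟩
      1 ℕ.+ q ^ suc m                                                ∎
      where
      open ℕ.≤-Reasoning
      Σ₀ = sum (map (λ a → count (nonzeroEigen? a) allV) elements)

  IsScalar : Mat → Set
  IsScalar M = Σ Carrier λ a → ∀ (x : Col) → Eigenspace M a x

  RankOneShift : Mat → Set
  RankOneShift M = Σ Carrier λ a → Σ Mat λ N → Rank1 N × Tr N ≢ 0# × (∀ i j → M i j ≡ N i j + a * δ i j)

  FewEigenvectors : Mat → Set
  FewEigenvectors M = 2 ℕ.+ #eigenvectors M ℕ.≤ q ^ suc m ℕ.+ q

  classification : ∀ M → IsScalar M ⊎ RankOneShift M ⊎ FewEigenvectors M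
  classification M = by-large (any? (λ a → q ^ m ℕ.<? #eigenspace M a) elements)
    where
    by-large : Dec (Any (λ a → q ^ m ℕ.< #eigenspace M a) elements) → IsScalar M ⊎ RankOneShift M ⊎ FewEigenvectors M
    by-large (no no-large) = inj₂ (inj₂ (bound (small-eigenspaces⇒fewEigenvectors M small)))
      where
      small : ∀ a → #eigenspace M a ℕ.≤ q ^ m
      small a = ℕ.≮⇒≥ (λ large → no-large (Any.map (λ { refl → large }) (complete a)))
      bound : #eigenvectors M ℕ.+ q ℕ.≤ 1 ℕ.+ q ^ suc m → FewEigenvectors M
      bound e+q≤1+Q = ℕ.≤-trans (ℕ.≤-trans (ℕ.≤-reflexive (ℕ.+-comm 2 _)) (ℕ.+-monoʳ-≤ _ 2≤q))
                        (ℕ.≤-trans e+q≤1+Q (ℕ.≤-trans (ℕ.≤-reflexive (ℕ.+-comm 1 _)) (ℕ.+-monoʳ-≤ _ (ℕ.≤-trans (ℕ.s≤s ℕ.z≤n) 2≤q))))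
    by-large (yes some-large) = from-large (satisfied some-large)
      where
      from-large : (Σ Carrier λ a → q ^ m ℕ.< #eigenspace M a) → IsScalar M ⊎ RankOneShift M ⊎ FewEigenvectors M
      from-large (a , large) = by-outside (any? (λ v → ¬? (eigenspace? M a v)) allV)
        where
        scalar : ¬ Any (λ v → ¬ Eigenspace M a (lookup v)) allV → ∀ x → Eigenspace M a x
        scalar none-outside x i = begin
          (M *ᵥ x) i                   ≡⟨ *ᵥ-cong M (λ r → sym (lookup∘tabulate x r)) i ⟩
          (M *ᵥ lookup (tabulate x)) i ≡⟨ decidable-stable (eigenspace? M a (tabulate x)) (λ outside → none-outside (Any.map (λ { refl → outside }) (∈-vectors (tabulate x)))) i ⟩
          a * lookup (tabulate x) i    ≡⟨ cong (a *_) (lookup∘tabulate x i) ⟩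
          a * x i                      ∎
          where open ≡-Reasoning
        few : #eigenvectors M ℕ.≤ q ^ suc m → FewEigenvectors M
        few e≤Q = ℕ.≤-trans (ℕ.≤-reflexive (ℕ.+-comm 2 _)) (ℕ.+-mono-≤ e≤Q 2≤q)
        by-outside : Dec (Any (λ v → ¬ Eigenspace M a (lookup v)) allV) → IsScalar M ⊎ RankOneShift M ⊎ FewEigenvectors M
        by-outside (no none-outside) = inj₁ (a , scalar none-outside)
        by-outside (yes some-outside) =
          inj₂ (Sum.map (a ,_) few (LargeEigenspace.rankOneShift-or-fewEigenvectors M a (proj₁ w) (proj₂ w) large))
          where w = satisfied some-outside

  E₀₀ : Mat
  E₀₀ i j = δ i zero * δ j zero

  E₀₀-*ᵥ : ∀ (x : Col) i → (E₀₀ *ᵥ x) i ≡ δ i zero * x zero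
  E₀₀-*ᵥ x i = trans (sumIdx-cong (λ j → solve 3 (λ a b c → (a :* b) :* c := (a :* c) :* b) refl (δ i zero) (δ j zero) (x j)))
                     (sumIdx-δʳ zero (λ j → δ i zero * x j))

  private
    #zeros : count (λ h → h ≟ 0#) elements ≡ 1
    #zeros = count-≡-1 _ elements unique 0# (complete 0#) refl (λ _ h≡0 → h≡0)

    HeadZero : V → Set
    HeadZero v = lookup v zero ≡ 0#

    headZero? : Decidable HeadZero
    headZero? v = lookup v zero ≟ 0#

    OnAxis : V → Set
    OnAxis v = lookup v zero ≢ 0# × Data.Vec.tail v ≡ replicate (suc m) 0#

    onAxis? : Decidable OnAxis
    onAxis? v = ¬? (lookup v zero ≟ 0#) ×-dec ≡-dec _≟_ (Data.Vec.tail v) (replicate (suc m) 0#)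

    #headZero : count headZero? allV ≡ q ^ suc m
    #headZero = begin
      count headZero? allV
        ≡⟨ count-cartesianProductWith headZero? _∷_ elements (vectors (suc m)) ⟩
      sum (map (λ h → count (λ _ → h ≟ 0#) (vectors (suc m))) elements)
        ≡⟨ sum-indicator (λ h → h ≟ 0#) (q ^ suc m) _ elements
             (λ h _ h≡0 → trans (count-all _ (vectors (suc m)) (λ _ _ → h≡0)) (length-vectors (suc m)))
             (λ h _ h≢0 → count-none _ (vectors (suc m)) (λ _ _ → h≢0)) ⟩
      count (λ h → h ≟ 0#) elements ℕ.* q ^ suc m
        ≡⟨ cong (ℕ._* q ^ suc m) #zeros ⟩
      1 ℕ.* q ^ suc m
        ≡⟨ ℕ.*-identityˡ _ ⟩
      q ^ suc m ∎
      where open ≡-Reasoning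

    #onAxis : count onAxis? allV ≡ count (λ h → ¬? (h ≟ 0#)) elements
    #onAxis = begin
      count onAxis? allV
        ≡⟨ count-cartesianProductWith onAxis? _∷_ elements (vectors (suc m)) ⟩
      sum (map (λ h → count (λ t → onAxis? (h ∷ t)) (vectors (suc m))) elements)
        ≡⟨ sum-indicator (λ h → ¬? (h ≟ 0#)) 1 _ elements
             (λ h _ h≢0 → count-≡-1 _ (vectors (suc m)) (vectors-unique (suc m)) (replicate (suc m) 0#) (∈-vectors (replicate (suc m) 0#)) (h≢0 , refl) (λ _ (_ , t≡0) → t≡0))
             (λ h _ ¬h≢0 → count-none _ (vectors (suc m)) (λ _ _ (h≢0 , _) → ¬h≢0 h≢0)) ⟩
      count (λ h → ¬? (h ≟ 0#)) elements ℕ.* 1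
        ≡⟨ ℕ.*-identityʳ _ ⟩
      count (λ h → ¬? (h ≟ 0#)) elements ∎
      where open ≡-Reasoning

    headZero⇒eigenvector : ∀ v → HeadZero v → Eigenvector E₀₀ (lookup v)
    headZero⇒eigenvector v v₀≡0 = 0# , λ i → trans (E₀₀-*ᵥ (lookup v) i)
      (trans (cong (δ i zero *_) v₀≡0) (trans (zeroʳ _) (sym (zeroˡ _))))

    onAxis⇒eigenvector : ∀ v → OnAxis v → Eigenvector E₀₀ (lookup v)
    onAxis⇒eigenvector (h ∷ t) (_ , refl) = 1# , λ i → trans (E₀₀-*ᵥ (lookup (h ∷ t)) i) (on-axis i)
      where
      on-axis : ∀ i → δ i zero * h ≡ 1# * lookup (h ∷ replicate (suc m) 0#) i
      on-axis zero    = trans (cong (_* h) (δ-refl zero)) refl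
      on-axis (suc r) = trans (cong (_* h) (δ-≢ {suc r} {zero} λ ())) (trans (zeroˡ h) (sym (trans (cong (1# *_) (lookup-replicate r 0#)) (zeroʳ 1#))))

  E₀₀-manyEigenvectors : q ^ suc m ℕ.+ q ℕ.≤ 1 ℕ.+ #eigenvectors E₀₀
  E₀₀-manyEigenvectors = begin
    q ^ suc m ℕ.+ q                                                     ≡⟨ cong (q ^ suc m ℕ.+_) (sym 1+#nonzeros) ⟩
    q ^ suc m ℕ.+ (1 ℕ.+ #nonzeros)                                     ≡⟨ ℕ.+-suc (q ^ suc m) #nonzeros ⟩
    1 ℕ.+ (q ^ suc m ℕ.+ #nonzeros)                                     ≡⟨ cong₂ (λ k l → 1 ℕ.+ (k ℕ.+ l)) #headZero #onAxis ⟨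
    1 ℕ.+ (count headZero? allV ℕ.+ count onAxis? allV)                 ≤⟨ ℕ.+-monoʳ-≤ 1 (ℕ.+-mono-≤
                                                                             (count-mono headZero? _ allV (λ v _ v₀≡0 → headZero⇒eigenvector v v₀≡0 , v₀≡0))
                                                                             (count-mono onAxis? _ allV (λ v _ axis → onAxis⇒eigenvector v axis , proj₁ axis))) ⟩
    1 ℕ.+ (count (λ v → eigenvector? E₀₀ v ×-dec headZero? v) allV ℕ.+ count (λ v → eigenvector? E₀₀ v ×-dec ¬? (headZero? v)) allV)
                                                                        ≡⟨ cong (1 ℕ.+_) (count-split (eigenvector? E₀₀) headZero? allV) ⟨
    1 ℕ.+ #eigenvectors E₀₀                                             ∎
    where
    open ℕ.≤-Reasoning
    #nonzeros = count (λ h → ¬? (h ≟ 0#)) elements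
    1+#nonzeros : 1 ℕ.+ #nonzeros ≡ q
    1+#nonzeros = trans (cong (ℕ._+ #nonzeros) (sym #zeros)) (count-complement (λ h → h ≟ 0#) elements)

  E₀₀-nonEigenvector : 0 ℕ.< count (λ v → ¬? (eigenvector? E₀₀ v)) allV
  E₀₀-nonEigenvector = count-some _ x (∈-vectors x) λ (l , E₀₀x≡lx) →
    let l≡0 : l ≡ 0#
        l≡0 = begin
          l                            ≡⟨ sym (*-identityʳ l) ⟩
          l * 1#                       ≡⟨ sym (E₀₀x≡lx (suc zero)) ⟩
          (E₀₀ *ᵥ lookup x) (suc zero) ≡⟨ E₀₀-*ᵥ (lookup x) (suc zero) ⟩
          δ (suc zero) zero * 1#       ≡⟨ cong (_* 1#) (δ-≢ {suc zero} {zero} λ ()) ⟩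
          0# * 1#                      ≡⟨ zeroˡ 1# ⟩
          0#                           ∎
    in 1≢0 (begin
          1#                           ≡⟨ sym (*-identityˡ 1#) ⟩
          1# * 1#                      ≡⟨ cong (_* 1#) (sym (δ-refl zero)) ⟩
          δ zero zero * 1#             ≡⟨ sym (E₀₀-*ᵥ (lookup x) zero) ⟩
          (E₀₀ *ᵥ lookup x) zero       ≡⟨ E₀₀x≡lx zero ⟩
          l * 1#                       ≡⟨ cong (_* 1#) l≡0 ⟩
          0# * 1#                      ≡⟨ zeroˡ 1# ⟩
          0#                           ∎)
    where
    open ≡-Reasoning
    x : V
    x = 1# ∷ 1# ∷ replicate _ 0#

module MinimumWeight (F : FiniteField) (m : ℕ) (Npts : ℕ) (Xs : Fin Npts → MatrixDefs.Mat F (suc m))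
                     (Λ₁ : MatrixDefs.IsProjSystemΛ₁ F (suc m) Npts Xs) where
  open import Data.Nat as ℕ using (ℕ; zero; suc; _≤_; _<_)
  open import Data.Fin using (Fin)

  import Data.Nat.Properties as ℕ
  open import Data.List using (allFin)
  open import Data.Product using (Σ; _×_; _,_; proj₁; proj₂)
  open import Data.Sum using (inj₁; inj₂)
  open import Data.Empty using (⊥-elim)
  open import Function.Bundles using (_⇔_; mk⇔)
  open import Relation.Nullary.Decidable using (¬?)
  open import Relation.Binary.PropositionalEquality using (_≡_; _≢_; refl; sym; trans; cong; subst₂; module ≡-Reasoning)
  open FieldProperties F
  open Counting
  open MatrixDefs F (suc m)
  open LinearAlgebra F (suc m)
  open Flags F (suc m)
  open WeightCount F (suc m) Npts Xs Λ₁
  open NonEigenvectorFibres F m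
  open EigenvectorCount F m

  wt : Mat → ℕ
  wt M = weight (codeword Xs M)

  #nonEigenvectors : Mat → ℕ
  #nonEigenvectors M = count (λ v → ¬? (eigenvector? M v)) allV

  weight-proportional : ∀ M → wt M ℕ.* #nonzeroPairs ≡ #nonEigenvectors M ℕ.* #zeroNonzero
  weight-proportional M = trans (sym (offHyperplane-count M)) (offHyperplane-count-eigen M)

  scalar⇒weight-zero : ∀ M → IsScalar M → wt M ≡ 0
  scalar⇒weight-zero M (a , scalar) = count-none _ (allFin Npts) (λ k _ cₖ≢0 → cₖ≢0 (codeword-zero k))
    where
    open ≡-Reasoning
    codeword-zero : ∀ k → codeword Xs M k ≡ 0#
    codeword-zero k = let (x , ξ , _ , _ , ξx≡0 , X≐xξ) = proj₁ Λ₁ k in begin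
      codeword Xs M k         ≡⟨ Tr-·-outer M X≐xξ ⟩
      rowCol ξ (M *ᵥ x)       ≡⟨ rowCol-cong {ξ} (λ _ → refl) (scalar x) ⟩
      rowCol ξ (λ i → a * x i) ≡⟨ rowCol-scaleʳ ξ x a ⟩
      a * rowCol ξ x          ≡⟨ cong (a *_) ξx≡0 ⟩
      a * 0#                  ≡⟨ zeroʳ a ⟩
      0#                      ∎

  shift⇒same-codeword : ∀ M N a → (∀ i j → M i j ≡ N i j + a * δ i j) → ∀ k → codeword Xs M k ≡ codeword Xs N k
  shift⇒same-codeword M N a M≡N+aI k = begin
    Tr (Xs k · M)                  ≡⟨ Tr-·-shift (Xs k) M N a M≡N+aI ⟩
    Tr (Xs k · N) + a * Tr (Xs k)  ≡⟨ cong (λ t → Tr (Xs k · N) + a * t) (Tr-Λ₁ k) ⟩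
    Tr (Xs k · N) + a * 0#         ≡⟨ cong (Tr (Xs k · N) +_) (zeroʳ a) ⟩
    Tr (Xs k · N) + 0#             ≡⟨ +-identityʳ _ ⟩
    Tr (Xs k · N)                  ∎
    where open ≡-Reasoning

  more-eigenvectors⇒smaller-weight : ∀ M M′ → #eigenvectors M < #eigenvectors M′ → wt M′ < wt M
  more-eigenvectors⇒smaller-weight M M′ fewer = ℕ.*-cancelʳ-< #nonzeroPairs _ _
    (subst₂ _<_ (sym (weight-proportional M′)) (sym (weight-proportional M))
      (ℕ.*-monoˡ-< #zeroNonzero {{ℕ.>-nonZero #zeroNonzero-positive}} more-non-eigen))
    where
    more-non-eigen : #nonEigenvectors M′ < #nonEigenvectors M
    more-non-eigen = ℕ.+-cancelˡ-< (#eigenvectors M) _ _ (ℕ.<-≤-trans (ℕ.+-monoˡ-< _ fewer) (ℕ.≤-reflexive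
      (trans (count-complement (eigenvector? M′) allV) (sym (count-complement (eigenvector? M) allV)))))

  E₀₀-weight-positive : 0 < wt E₀₀
  E₀₀-weight-positive = ℕ.*-cancelʳ-< #nonzeroPairs 0 (wt E₀₀)
    (subst₂ _<_ refl (sym (weight-proportional E₀₀)) (ℕ.*-mono-< E₀₀-nonEigenvector #zeroNonzero-positive))

  minimal-weight⇒rankOneShift : ∀ M → 0 < wt M → (∀ M′ → 0 < wt M′ → wt M ≤ wt M′) → RankOneShift M
  minimal-weight⇒rankOneShift M positive minimal with classification M
  ... | inj₁ scalar = ⊥-elim (ℕ.<⇒≢ positive (sym (scalar⇒weight-zero M scalar)))
  ... | inj₂ (inj₁ shift) = shift
  ... | inj₂ (inj₂ few) = ⊥-elim (ℕ.<⇒≱ (more-eigenvectors⇒smaller-weight M E₀₀ fewer) (minimal E₀₀ E₀₀-weight-positive))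
    where
    fewer : #eigenvectors M < #eigenvectors E₀₀
    fewer = ℕ.+-cancelˡ-≤ 1 _ _ (ℕ.≤-trans few E₀₀-manyEigenvectors)

open import Data.Nat using (_≤_; _<_)
open import Data.Product using (Σ; _×_; _,_)
open import Data.Empty using (⊥-elim)
open import Relation.Nullary using (¬_)
open import Relation.Binary.PropositionalEquality using (_≡_; _≢_; sym; trans)
open import Function.Bundles using (_⇔_; mk⇔)

Λ₁-empty-on-the-line : ∀ F (X : MatrixDefs.Mat F zero) → ¬ MatrixDefs.InΛ₁ F zero X
Λ₁-empty-on-the-line F X (x , ξ , (zero , x₀≢0) , (zero , ξ₀≢0) , ξx≡0 , _) =
  *-nonzero ξ₀≢0 x₀≢0 (trans (sym (+-identityʳ _)) ξx≡0)
  where open FieldProperties F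

proposition3p15 : (F : FiniteField) (n : ℕ) (Npts : ℕ)
    → (Xs : Fin Npts → MatrixDefs.Mat F n)
    → MatrixDefs.IsProjSystemΛ₁ F n Npts Xs
    → (M : MatrixDefs.Mat F n)
    → 0 < MatrixDefs.weight F n (MatrixDefs.codeword F n Xs M)
    → (∀ M′ → 0 < MatrixDefs.weight F n (MatrixDefs.codeword F n Xs M′)
            → MatrixDefs.weight F n (MatrixDefs.codeword F n Xs M)
              ≤ MatrixDefs.weight F n (MatrixDefs.codeword F n Xs M′))
    → Σ (MatrixDefs.Mat F n) λ N →
        MatrixDefs.Rank1 F n N
        × MatrixDefs.Tr F n N ≢ FiniteField.0# F
        × (∀ k → (MatrixDefs.codeword F n Xs M k ≡ FiniteField.0# F)
                 ⇔ (MatrixDefs.codeword F n Xs N k ≡ FiniteField.0# F))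
proposition3p15 F zero zero Xs Λ₁ M () minimal
proposition3p15 F zero (suc _) Xs (inΛ₁ , _) M positive minimal = ⊥-elim (Λ₁-empty-on-the-line F (Xs zero) (inΛ₁ zero))
proposition3p15 F (suc m) Npts Xs Λ₁ M positive minimal =
  let (a , N , rank1 , TrN≢0 , M≡N+aI) = minimal-weight⇒rankOneShift M positive minimal
      same = shift⇒same-codeword M N a M≡N+aI
  in N , rank1 , TrN≢0 , λ k → mk⇔ (trans (sym (same k))) (trans (same k))
  where open MinimumWeight F m Npts Xs Λ₁
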